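{- Let $\phi$ be an MTL$^{\downarrow}$ formula, $\mu$ and $\nu$ partial valuations, $u$ and $v$ observations, and $\tau\in\mathbb{Q}_{\geq0}$. If $u\sqsubseteq v$ and $\mu\sqsubseteq\nu$, then $[\![\phi]\!]^{\tau}_{u,\mu}\preceq[\![\phi]\!]^{\tau}_{v,\nu}$.
   Context: Setting. Fix a finite set $P$ of predicate symbols with arities $\iota(p)$, a set $V$ of variables, a finite set $R$ of registers, and a nonempty data domain $D$ with $\bot\notin D$. MTL$^{\downarrow}$ formulas: $\phi ::= \mathsf{t}\mid p(x_1,\dots,x_{\iota(p)})\mid {\downarrow^{r}}x.\,\phi\mid\neg\phi\mid\phi\vee\phi\mid \bullet_I\phi\ (\text{previous})\mid \circ_I\phi\ (\text{next})\mid\phi\,\mathsf{S}_I\,\phi\mid\phi\,\mathsf{U}_I\,\phi$, with $I$ an interval of $\mathbb{Q}_{\geq0}$ and ${\downarrow^r}x$ the freeze quantifier binding $x$ to the value of register $r$. For intervals, $A-B:=\{a-b\mid a\in A,b\in B\}\cap\mathbb{Q}_{\geq0}$. Truth values $\{\mathsf{t},\mathsf{f},\bot\}$ with strong Kleene connectives and knowledge order $\bot\prec\mathsf{t}$, $\bot\prec\mathsf{f}$; $\preceq$ is its reflexive closure. Alphabet $\Sigma$: pairs $(\sigma,\rho)$ of partial functions $\sigma:P\rightharpoonup\bigcup_p 2^{D^{\iota(p)}}$, $\rho:R\rightharpoonup D$, ordered by extension ($\sqsubseteq$); the least element is the pair of everywhere-undefined maps. Observations are finite words of letters $(I,a)$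 defined inductively: $([0,\infty),a_0)$ with $a_0$ the least letter is an observation; applying one of (T1) replace a letter $(I,a)$ with $|I|>1$ by $(I\cap[0,\tau),a)(\{\tau\},a)(I\cap(\tau,\infty),a)$ for some $\tau\in I$, $\tau>0$ (for $\tau=0$: $(\{0\},a)(I\cap(0,\infty),a)$), (T2) remove a letter $(I,a)$ with $|I|>1$ and $I$ bounded, (T3) replace a letter $(I,a)$ with $|I|=1$ by $(I,a')$ with $a\sqsubseteq a'$, yields an observation. $u\sqsubseteq v$ for observations means $v$ is obtained from $u$ by finitely many (possibly zero) such transformations. Position $i$ is a time point if its interval $I_i$ is a singleton; its element is its timestamp. For valuations, $\mu\sqsubseteq\nu$ means $\nu$ extends $\mu$. Three-valued semantics $[\![\phi]\!]_{w,i,\nu}$ for $w=(I_0,(\sigma_0,\rho_0))\dots(I_{n-1},(\sigma_{n-1},\rho_{n-1}))$, position $i$, partial valuation $\nu$: $[\![\mathsf{t}]\!]=\mathsf{t}$; $[\![p(\bar x)]\!]_{w,i,\nu}$ is $\mathsf{t}$ (resp. $\mathsf{f}$) if $\bar x\subseteq\mathrm{def}(\nu)$, $p\in\mathrm{def}(\sigma_i)$ and $\nu(\bar x)\in\sigma_i(p)$ (resp. $\notin$), else $\bot$; $[\![{\downarrow^r}x.\phi]\!]_{w,i,\nu}=[\![\phi]\!]_{w,i,\nu[x\mapsto\rho_i(r)]}$ if $r\in\mathrm{def}(\rho_i)$, otherwise evaluated with $x$ undefined; $\neg,\vee$ via Kleene. With $\mathrm{tp}_w(i)=\mathsf{t}$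 if $|I_i|=1$ else $\bot$, and $\mathrm{mc}_{w,I}(i,j)=\mathsf{t}$ if $I_i-I_j\neq\emptyset$ and $I_i-I_j\subseteq I$, $\mathsf{f}$ if $(I_i-I_j)\cap I=\emptyset$, $\bot$ otherwise: $[\![\phi\,\mathsf{S}_I\psi]\!]_{w,i,\nu}=\bigvee_{j\le i}\big(\mathrm{tp}_w(j)\wedge\mathrm{mc}_{w,I}(i,j)\wedge[\![\psi]\!]_{w,j,\nu}\wedge\bigwedge_{j<k\le i}(\mathrm{tp}_w(k)\to[\![\phi]\!]_{w,k,\nu})\big)$; $[\![\phi\,\mathsf{U}_I\psi]\!]_{w,i,\nu}=\bigvee_{j\ge i}\big(\mathrm{tp}_w(j)\wedge\mathrm{mc}_{w,I}(j,i)\wedge[\![\psi]\!]_{w,j,\nu}\wedge\bigwedge_{i\le k<j}(\mathrm{tp}_w(k)\to[\![\phi]\!]_{w,k,\nu})\big)$; $[\![\bullet_I\phi]\!]_{w,i,\nu}=c_0\vee c_{ -1}\vee c_{ -2}$ and $[\![\circ_I\phi]\!]_{w,i,\nu}=c_0\vee c_1\vee c_2$, where $c_0=\mathrm{mc}_{w,I}(i,i)\wedge[\![\phi]\!]_{w,i,\nu}\wedge\neg\mathrm{tp}_w(i)$ if $I\neq\{0\}$; $c_{\pm1}=\mathrm{mc}_{w,I}(\max(i,i\pm1),\min(i,i\pm1))\wedge[\![\phi]\!]_{w,i\pm1,\nu}\wedge\mathrm{tp}_w(i\pm1)\wedge\mathrm{tp}_w(i)$ if $i\pm1$ is a position; $c_{\pm2}=\mathrm{mc}_{w,I}(\max(i,i\pm2),\min(i,i\pm2))\wedge[\![\phi]\!]_{w,i\pm2,\nu}\wedge\neg\mathrm{tp}_w(i\pm1)$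 if $i\pm2$ is a position; each $c_k$ is $\mathsf{f}$ when its side condition fails. Timestamp version: $[\![\phi]\!]^{\tau}_{w,\nu}:=[\![\phi]\!]_{w,i,\nu}$ if $\tau$ is the timestamp of a time point $i$ of $w$, and $\bot$ otherwise. -}

module Defs where

open import Level using (0ℓ)
open import Data.Nat as ℕ using (ℕ; zero; suc; _∸_)
open import Data.Bool using (Bool; true; false; if_then_else_)
open import Data.Fin using (Fin)
open import Data.Maybe using (Maybe; just; nothing)
open import Data.Vec using (Vec; []; _∷_)
open import Data.List as List using (List; []; _∷_; _++_; length; upTo; filter; map; foldr; lookup)
open import Data.Product using (Σ; ∃; _×_; _,_; proj₁; proj₂)
open import Data.Sum using (_⊎_)
open import Data.Empty using (⊥)
open import Data.Rational using (ℚ; 0ℚ; _≤_; _<_; _-_)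
open import Data.Rational.Properties using (≤-antisym; ≤-trans; ≤-<-trans; <-≤-trans; <⇒≤)
open import Relation.Nullary using (Dec; yes; no; does; ¬_)
open import Relation.Unary using (Pred)
open import Relation.Binary.PropositionalEquality using (_≡_; _≢_; refl; sym; trans)
open import Relation.Binary.Construct.Closure.ReflexiveTransitive using (Star)

data TV : Set where
  tt ff ⊥v : TV

¬ₖ_ : TV → TV
¬ₖ tt = ff
¬ₖ ff = tt
¬ₖ ⊥v = ⊥v

infixr 6 _∧ₖ_
infixr 5 _∨ₖ_ _→ₖ_

_∧ₖ_ : TV → TV → TV
ff ∧ₖ _  = ff
tt ∧ₖ b  = b
⊥v ∧ₖ ff = ff
⊥v ∧ₖ _  = ⊥v

_∨ₖ_ : TV → TV → TV
tt ∨ₖ _  = tt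
ff ∨ₖ b  = b
⊥v ∨ₖ tt = tt
⊥v ∨ₖ _  = ⊥v

_→ₖ_ : TV → TV → TV
a →ₖ b = (¬ₖ a) ∨ₖ b

⋁ : List TV → TV
⋁ = foldr _∨ₖ_ ff

⋀ : List TV → TV
⋀ = foldr _∧ₖ_ tt

_⪯_ : TV → TV → Set
a ⪯ b = (a ≡ ⊥v) ⊎ (a ≡ b)

-- Classical oracle: every proposition is decided (the paper works
-- classically)

LEM : Set₁
LEM = (A : Set) → Dec A

-- Intervals of ℚ≥0 (arbitrary convex subsets of ℚ≥0, possibly empty)

record Interval : Set₁ where
  field
    mem    : ℚ → Set
    nonneg : ∀ {q} → mem q → 0ℚ ≤ q
    convex : ∀ {a b c} → mem a → mem c → a ≤ b → b ≤ c → mem b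
open Interval public

NonSingleton : Interval → Set
NonSingleton I = Σ ℚ λ a → Σ ℚ λ b → mem I a × mem I b × a ≢ b

IsSingletonOf : Interval → ℚ → Set
IsSingletonOf I τ = mem I τ × (∀ q → mem I q → q ≡ τ)

IsSingleton : Interval → Set
IsSingleton I = Σ ℚ λ τ → IsSingletonOf I τ

Bounded : Interval → Set
Bounded I = Σ ℚ λ M → ∀ q → mem I q → q ≤ M

IsZeroSet : Interval → Set
IsZeroSet I = ∀ q → (mem I q → q ≡ 0ℚ) × (q ≡ 0ℚ → mem I q)

[0,∞[ : Interval
[0,∞[ = record { mem = λ q → 0ℚ ≤ q ; nonneg = λ p → p
               ; convex = λ a≤ _ a≤b _ → ≤-trans a≤ a≤b }

sing : (τ : ℚ) → 0ℚ ≤ τ → Interval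
sing τ 0≤τ = record { mem = λ q → q ≡ τ ; nonneg = λ { refl → 0≤τ }
                   ; convex = λ { refl refl a≤b b≤c → ≤-antisym b≤c a≤b } }

_∩<_ : Interval → ℚ → Interval
I ∩< τ = record
  { mem = λ q → mem I q × q < τ
  ; nonneg = λ p → nonneg I (proj₁ p)
  ; convex = λ pa pc a≤b b≤c →
      convex I (proj₁ pa) (proj₁ pc) a≤b b≤c , ≤-<-trans b≤c (proj₂ pc) }

_∩>_ : Interval → ℚ → Interval
I ∩> τ = record
  { mem = λ q → mem I q × τ < q
  ; nonneg = λ p → nonneg I (proj₁ p)
  ; convex = λ pa pc a≤b b≤c →
      convex I (proj₁ pa) (proj₁ pc) a≤b b≤c , <-≤-trans (proj₂ pa) a≤b }

_⊖_ : Interval → Interval → ℚ → Set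
(A ⊖ B) q = (0ℚ ≤ q) × Σ ℚ λ a → Σ ℚ λ b → mem A a × mem B b × q ≡ a - b

module Setting (nP : ℕ) (ι : Fin nP → ℕ) (V : Set) (nR : ℕ) (D : Set)
               (lem : LEM) where

  P R : Set
  P = Fin nP
  R = Fin nR

  data Formula : Set₁ where
    T      : Formula
    Atom   : (p : P) → Vec V (ι p) → Formula
    Freeze : R → V → Formula → Formula
    Neg    : Formula → Formula
    Or     : Formula → Formula → Formula
    Prev   : Interval → Formula → Formula
    Next   : Interval → Formula → Formula
    Since  : Interval → Formula → Formula → Formula
    Until  : Interval → Formula → Formula → Formula

  record Letter : Set₁ where
    constructor ⟨_,_⟩
    field
      σ : (p : P) → Maybe (Pred (Vec D (ι p)) 0ℓ)
      ρ : R → Maybe D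
  open Letter public

  _⊑ˡ_ : Letter → Letter → Set₁
  a ⊑ˡ b = (∀ p S → σ a p ≡ just S → σ b p ≡ just S)
         × (∀ r d → ρ a r ≡ just d → ρ b r ≡ just d)

  ⊥letter : Letter
  ⊥letter = ⟨ (λ _ → nothing) , (λ _ → nothing) ⟩

  Word : Set₁
  Word = List (Interval × Letter)

  data Step : Word → Word → Set₁ where
    T1  : ∀ xs ys I a τ → NonSingleton I → (τ∈I : mem I τ) → 0ℚ < τ →
          Step (xs ++ (I , a) ∷ ys)
               (xs ++ (I ∩< τ , a) ∷ (sing τ (nonneg I τ∈I) , a)
                   ∷ (I ∩> τ , a) ∷ ys)
    T1₀ : ∀ xs ys I a → NonSingleton I → (0∈I : mem I 0ℚ) →
          Step (xs ++ (I , a) ∷ ys)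
               (xs ++ (sing 0ℚ (nonneg I 0∈I) , a) ∷ (I ∩> 0ℚ , a) ∷ ys)
    T2  : ∀ xs ys I a → NonSingleton I → Bounded I →
          Step (xs ++ (I , a) ∷ ys) (xs ++ ys)
    T3  : ∀ xs ys I a a′ → IsSingleton I → a ⊑ˡ a′ →
          Step (xs ++ (I , a) ∷ ys) (xs ++ (I , a′) ∷ ys)

  initial : Word
  initial = ([0,∞[ , ⊥letter) ∷ []

  _⊑ᵒ_ : Word → Word → Set₁
  _⊑ᵒ_ = Star Step

  IsObservation : Word → Set₁
  IsObservation u = initial ⊑ᵒ u

  Val : Set
  Val = V → Maybe D

  _⊑ᵛ_ : Val → Val → Set
  μ ⊑ᵛ ν = ∀ x d → μ x ≡ just d → ν x ≡ just d

  _[_↦_] : Val → V → Maybe D → Val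
  (ν [ x ↦ m ]) y = if does (lem (x ≡ y)) then m else ν y

  valVec : ∀ {n} → Val → Vec V n → Maybe (Vec D n)
  valVec ν [] = just []
  valVec ν (x ∷ xs) with ν x | valVec ν xs
  ... | just d | just ds = just (d ∷ ds)
  ... | _      | _       = nothing

  at : Word → ℕ → Maybe (Interval × Letter)
  at [] _ = nothing
  at (e ∷ w) zero = just e
  at (e ∷ w) (suc i) = at w i

  range : ℕ → ℕ → List ℕ
  range a b = filter (λ j → a ℕ.≤? j) (upTo b)

  tp : Word → ℕ → TV
  tp w i with at w i
  ... | just (I , _) = if does (lem (IsSingleton I)) then tt else ⊥v
  ... | nothing      = ⊥v

  mc : Word → Interval → ℕ → ℕ → TV
  mc w I i j with at w i | at w j
  ... | just (Ii , _) | just (Ij , _) =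
        if does (lem ((Σ ℚ λ q → (Ii ⊖ Ij) q) × (∀ q → (Ii ⊖ Ij) q → mem I q)))
        then tt
        else (if does (lem (∀ q → (Ii ⊖ Ij) q → ¬ mem I q)) then ff else ⊥v)
  ... | _ | _ = ⊥v

  notZero : Interval → Bool
  notZero I = if does (lem (IsZeroSet I)) then false else true

  -- side condition "k is a position", then the value, else f
  guard : Bool → TV → TV
  guard b t = if b then t else ff

  ⟦_⟧ : Formula → Word → ℕ → Val → TV
  ⟦ T ⟧ w i ν = tt
  ⟦ Atom p xs ⟧ w i ν with at w i | valVec ν xs
  ... | just (_ , a) | just ds with σ a p
  ...    | just S = if does (lem (S ds)) then tt else ff
  ...    | nothing = ⊥v
  ⟦ Atom p xs ⟧ w i ν | _ | _ = ⊥v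
  ⟦ Freeze r x φ ⟧ w i ν with at w i
  ... | just (_ , a) = ⟦ φ ⟧ w i (ν [ x ↦ ρ a r ])
  ... | nothing      = ⊥v
  ⟦ Neg φ ⟧ w i ν = ¬ₖ (⟦ φ ⟧ w i ν)
  ⟦ Or φ ψ ⟧ w i ν = ⟦ φ ⟧ w i ν ∨ₖ ⟦ ψ ⟧ w i ν
  ⟦ Since I φ ψ ⟧ w i ν =
    ⋁ (map (λ j → tp w j ∧ₖ mc w I i j ∧ₖ ⟦ ψ ⟧ w j ν
                  ∧ₖ ⋀ (map (λ k → tp w k →ₖ ⟦ φ ⟧ w k ν) (range (suc j) (suc i))))
           (range 0 (suc i)))
  ⟦ Until I φ ψ ⟧ w i ν =
    ⋁ (map (λ j → tp w j ∧ₖ mc w I j i ∧ₖ ⟦ ψ ⟧ w j ν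
                  ∧ₖ ⋀ (map (λ k → tp w k →ₖ ⟦ φ ⟧ w k ν) (range i j)))
           (range i (length w)))
  ⟦ Prev I φ ⟧ w i ν =
    guard (notZero I) (mc w I i i ∧ₖ ⟦ φ ⟧ w i ν ∧ₖ ¬ₖ tp w i)
    ∨ₖ guard (1 ℕ.≤ᵇ i)
         (mc w I i (i ∸ 1) ∧ₖ ⟦ φ ⟧ w (i ∸ 1) ν ∧ₖ tp w (i ∸ 1) ∧ₖ tp w i)
    ∨ₖ guard (2 ℕ.≤ᵇ i)
         (mc w I i (i ∸ 2) ∧ₖ ⟦ φ ⟧ w (i ∸ 2) ν ∧ₖ ¬ₖ tp w (i ∸ 1))
  ⟦ Next I φ ⟧ w i ν =
    guard (notZero I) (mc w I i i ∧ₖ ⟦ φ ⟧ w i ν ∧ₖ ¬ₖ tp w i)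
    ∨ₖ guard (suc i ℕ.<ᵇ length w)
         (mc w I (suc i) i ∧ₖ ⟦ φ ⟧ w (suc i) ν ∧ₖ tp w (suc i) ∧ₖ tp w i)
    ∨ₖ guard (suc (suc i) ℕ.<ᵇ length w)
         (mc w I (suc (suc i)) i ∧ₖ ⟦ φ ⟧ w (suc (suc i)) ν ∧ₖ ¬ₖ tp w (suc i))

  TimePointAt : Word → ℚ → ℕ → Set
  TimePointAt w τ i with at w i
  ... | just (I , _) = IsSingletonOf I τ
  ... | nothing      = ⊥

  ⟦_⟧^_ : Formula → ℚ → Word → Val → TV
  (⟦ φ ⟧^ τ) w ν with lem (Σ ℕ λ i → TimePointAt w τ i)
  ... | yes (i , _) = ⟦ φ ⟧ w i ν
  ... | no _        = ⊥v

module Submission where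

open import Defs
open import Data.Nat using (ℕ)
open import Data.Fin using (Fin)
open import Data.Rational using (ℚ; 0ℚ; _≤_)

open import Data.Nat as ℕ using (zero; suc; z≤n; s≤s; _+_)
open import Data.Nat.Properties as ℕP using ()
open import Data.Bool using (true; false; if_then_else_)
open import Data.Bool.Properties using (T-≡)
open import Data.Unit using (⊤)
open import Data.Maybe using (Maybe; just; nothing)
open import Data.Vec using (Vec; []; _∷_)
open import Data.List using ([]; _∷_; _++_; length; map)
open import Data.List.Membership.Propositional using (_∈_)
open import Data.List.Membership.Propositional.Properties using (∈-filter⁺; ∈-filter⁻; ∈-upTo⁺; ∈-upTo⁻)
open import Data.List.Relation.Unary.Any using (here; there)
open import Data.List.Relation.Unary.All as All using (All; []; _∷_)
import Data.List.Relation.Unary.All.Properties as Allₚ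
open import Data.List.Relation.Unary.AllPairs using (AllPairs; []; _∷_)
import Data.List.Relation.Unary.AllPairs.Properties as AllPairsₚ
open import Data.List.Relation.Unary.Linked using (Linked; []; [-]; _∷_)
open import Data.Product using (Σ; ∃; _×_; _,_; proj₁; proj₂)
open import Data.Sum using (_⊎_; inj₁; inj₂) renaming (map to ⊎-map; map₂ to ⊎-map₂)
open import Data.Empty using (⊥; ⊥-elim)
open import Data.Rational as ℚ using (1ℚ; _-_; -_)
open import Data.Rational.Properties as ℚP using ()
open import Function.Bundles using (Equivalence)
open import Relation.Nullary using (Dec; yes; no; does; ¬_)
open import Relation.Binary.Definitions using (tri<; tri≈; tri>)
open import Relation.Binary.PropositionalEquality using (_≡_; _≢_; refl; sym; trans; cong; subst; subst₂)
open import Relation.Binary.Construct.Closure.ReflexiveTransitive using (ε; _◅_)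

-- A refinement is a finite sequence of transformations (T1)–(T3) and ⪯ is
-- transitive, so it suffices to treat one step u → v.  Each step induces a
-- simulation: a strictly monotone correspondence of positions under which
-- every position of v refines (smaller interval, extended letter) a position
-- of u, and every time point of u survives at exactly one position of v.
-- By induction on φ the pointwise semantics at related positions only gains
-- definite values (semantics-≼).  The temporal cases rely on observations
-- being well formed — entries are nonempty, strictly ordered in time and no
-- two gaps are adjacent — so that the simulation reflects which positions
-- are neighbouring time points, as needed by •, ∘, S and U.  Finally, a
-- timestamp names at most one time point, and its image keeps the timestamp.

-- a ≼ b : every definite value of a is kept by b.  This is the pointwise
-- reading of the knowledge order; it is the form in which monotonicity is
-- propagated through the connectives.
record _≼_ (a b : TV) : Set where
  constructor keeps
  field
    keeps-tt : a ≡ tt → b ≡ tt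
    keeps-ff : a ≡ ff → b ≡ ff
open _≼_ public

≼⇒⪯ : ∀ {a b} → a ≼ b → a ⪯ b
≼⇒⪯ {tt} a≼b = inj₂ (sym (keeps-tt a≼b refl))
≼⇒⪯ {ff} a≼b = inj₂ (sym (keeps-ff a≼b refl))
≼⇒⪯ {⊥v} a≼b = inj₁ refl

⪯-trans : ∀ {a b c} → a ⪯ b → b ⪯ c → a ⪯ c
⪯-trans (inj₁ refl) _ = inj₁ refl
⪯-trans (inj₂ refl) b⪯c = b⪯c

∧-tt⁻ : ∀ a b → a ∧ₖ b ≡ tt → a ≡ tt × b ≡ tt
∧-tt⁻ tt tt _ = refl , refl
∧-tt⁻ tt ff ()
∧-tt⁻ tt ⊥v ()
∧-tt⁻ ⊥v tt ()
∧-tt⁻ ⊥v ff ()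
∧-tt⁻ ⊥v ⊥v ()

∧-tt⁺ : ∀ {a b} → a ≡ tt → b ≡ tt → a ∧ₖ b ≡ tt
∧-tt⁺ refl refl = refl

∧-ff⁻ : ∀ a b → a ∧ₖ b ≡ ff → a ≡ ff ⊎ b ≡ ff
∧-ff⁻ ff b _ = inj₁ refl
∧-ff⁻ tt b b≡ff = inj₂ b≡ff
∧-ff⁻ ⊥v ff _ = inj₂ refl
∧-ff⁻ ⊥v tt ()
∧-ff⁻ ⊥v ⊥v ()

∧-ff⁺ : ∀ a b → a ≡ ff ⊎ b ≡ ff → a ∧ₖ b ≡ ff
∧-ff⁺ a b (inj₁ refl) = refl
∧-ff⁺ tt b (inj₂ refl) = refl
∧-ff⁺ ff b (inj₂ refl) = refl
∧-ff⁺ ⊥v b (inj₂ refl) = refl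

∨-tt⁻ : ∀ a b → a ∨ₖ b ≡ tt → a ≡ tt ⊎ b ≡ tt
∨-tt⁻ tt b _ = inj₁ refl
∨-tt⁻ ff b b≡tt = inj₂ b≡tt
∨-tt⁻ ⊥v tt _ = inj₂ refl
∨-tt⁻ ⊥v ff ()
∨-tt⁻ ⊥v ⊥v ()

∨-tt⁺ : ∀ a b → a ≡ tt ⊎ b ≡ tt → a ∨ₖ b ≡ tt
∨-tt⁺ a b (inj₁ refl) = refl
∨-tt⁺ tt b (inj₂ refl) = refl
∨-tt⁺ ff b (inj₂ refl) = refl
∨-tt⁺ ⊥v b (inj₂ refl) = refl

∨-ff⁻ : ∀ a b → a ∨ₖ b ≡ ff → a ≡ ff × b ≡ ff
∨-ff⁻ ff ff _ = refl , refl
∨-ff⁻ tt b ()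
∨-ff⁻ ff tt ()
∨-ff⁻ ff ⊥v ()
∨-ff⁻ ⊥v tt ()
∨-ff⁻ ⊥v ff ()
∨-ff⁻ ⊥v ⊥v ()

∨-ff⁺ : ∀ {a b} → a ≡ ff → b ≡ ff → a ∨ₖ b ≡ ff
∨-ff⁺ refl refl = refl

¬-tt⁻ : ∀ a → ¬ₖ a ≡ tt → a ≡ ff
¬-tt⁻ ff _ = refl
¬-tt⁻ tt ()
¬-tt⁻ ⊥v ()

¬-ff⁻ : ∀ a → ¬ₖ a ≡ ff → a ≡ tt
¬-ff⁻ tt _ = refl
¬-ff⁻ ff ()
¬-ff⁻ ⊥v ()

¬-ff⁺ : ∀ {a} → a ≡ tt → ¬ₖ a ≡ ff
¬-ff⁺ refl = refl

≼-¬ : ∀ {a b} → a ≼ b → (¬ₖ a) ≼ (¬ₖ b)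
≼-¬ {a} {b} a≼b = keeps
  (λ e → flip-ff (keeps-ff a≼b (¬-tt⁻ a e)))
  (λ e → ¬-ff⁺ (keeps-tt a≼b (¬-ff⁻ a e)))
  where
  flip-ff : ∀ {c} → c ≡ ff → ¬ₖ c ≡ tt
  flip-ff refl = refl

≼-∨ : ∀ {a b c d} → a ≼ b → c ≼ d → (a ∨ₖ c) ≼ (b ∨ₖ d)
≼-∨ {a} {b} {c} {d} a≼b c≼d = keeps
  (λ e → ∨-tt⁺ b d (⊎-map (keeps-tt a≼b) (keeps-tt c≼d) (∨-tt⁻ a c e)))
  (λ e → let (a≡ff , c≡ff) = ∨-ff⁻ a c e in ∨-ff⁺ (keeps-ff a≼b a≡ff) (keeps-ff c≼d c≡ff))

∧-keeps-tt : ∀ {a b c d} → (a ≡ tt → b ≡ tt) → (c ≡ tt → d ≡ tt) → a ∧ₖ c ≡ tt → b ∧ₖ d ≡ tt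
∧-keeps-tt {a} {b} {c} {d} a-tt c-tt e = let (a≡tt , c≡tt) = ∧-tt⁻ a c e in ∧-tt⁺ (a-tt a≡tt) (c-tt c≡tt)

∧-keeps-ff : ∀ {a b c d} → (a ≡ ff → b ≡ ff) → (c ≡ ff → d ≡ ff) → a ∧ₖ c ≡ ff → b ∧ₖ d ≡ ff
∧-keeps-ff {a} {b} {c} {d} a-ff c-ff e = ∧-ff⁺ b d (⊎-map a-ff c-ff (∧-ff⁻ a c e))

≼-∧ : ∀ {a b c d} → a ≼ b → c ≼ d → (a ∧ₖ c) ≼ (b ∧ₖ d)
≼-∧ a≼b c≼d = keeps (∧-keeps-tt (keeps-tt a≼b) (keeps-tt c≼d)) (∧-keeps-ff (keeps-ff a≼b) (keeps-ff c≼d))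

≼-→ : ∀ {a b c d} → a ≼ b → c ≼ d → (a →ₖ c) ≼ (b →ₖ d)
≼-→ a≼b c≼d = ≼-∨ (≼-¬ a≼b) c≼d

module _ (f : ℕ → TV) where

  ⋁-tt⁻ : ∀ xs → ⋁ (map f xs) ≡ tt → ∃ λ j → j ∈ xs × f j ≡ tt
  ⋁-tt⁻ (x ∷ xs) e with ∨-tt⁻ (f x) _ e
  ... | inj₁ fx = x , here refl , fx
  ... | inj₂ rest = let (j , j∈ , fj) = ⋁-tt⁻ xs rest in j , there j∈ , fj

  ⋁-tt⁺ : ∀ {j} xs → j ∈ xs → f j ≡ tt → ⋁ (map f xs) ≡ tt
  ⋁-tt⁺ (x ∷ xs) (here refl) fj = ∨-tt⁺ (f x) _ (inj₁ fj)
  ⋁-tt⁺ (x ∷ xs) (there j∈) fj = ∨-tt⁺ (f x) _ (inj₂ (⋁-tt⁺ xs j∈ fj))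

  ⋁-ff⁻ : ∀ {j} xs → ⋁ (map f xs) ≡ ff → j ∈ xs → f j ≡ ff
  ⋁-ff⁻ (x ∷ xs) e (here refl) = proj₁ (∨-ff⁻ (f x) _ e)
  ⋁-ff⁻ (x ∷ xs) e (there j∈) = ⋁-ff⁻ xs (proj₂ (∨-ff⁻ (f x) _ e)) j∈

  ⋁-ff⁺ : ∀ xs → (∀ {j} → j ∈ xs → f j ≡ ff) → ⋁ (map f xs) ≡ ff
  ⋁-ff⁺ [] _ = refl
  ⋁-ff⁺ (x ∷ xs) all-ff = ∨-ff⁺ (all-ff (here refl)) (⋁-ff⁺ xs (λ j∈ → all-ff (there j∈)))

  ⋀-ff⁻ : ∀ xs → ⋀ (map f xs) ≡ ff → ∃ λ j → j ∈ xs × f j ≡ ff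
  ⋀-ff⁻ (x ∷ xs) e with ∧-ff⁻ (f x) _ e
  ... | inj₁ fx = x , here refl , fx
  ... | inj₂ rest = let (j , j∈ , fj) = ⋀-ff⁻ xs rest in j , there j∈ , fj

  ⋀-ff⁺ : ∀ {j} xs → j ∈ xs → f j ≡ ff → ⋀ (map f xs) ≡ ff
  ⋀-ff⁺ (x ∷ xs) (here refl) fj = ∧-ff⁺ (f x) _ (inj₁ fj)
  ⋀-ff⁺ (x ∷ xs) (there j∈) fj = ∧-ff⁺ (f x) _ (inj₂ (⋀-ff⁺ xs j∈ fj))

  ⋀-tt⁻ : ∀ {j} xs → ⋀ (map f xs) ≡ tt → j ∈ xs → f j ≡ tt
  ⋀-tt⁻ (x ∷ xs) e (here refl) = proj₁ (∧-tt⁻ (f x) _ e)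
  ⋀-tt⁻ (x ∷ xs) e (there j∈) = ⋀-tt⁻ xs (proj₂ (∧-tt⁻ (f x) _ e)) j∈

  ⋀-tt⁺ : ∀ xs → (∀ {j} → j ∈ xs → f j ≡ tt) → ⋀ (map f xs) ≡ tt
  ⋀-tt⁺ [] _ = refl
  ⋀-tt⁺ (x ∷ xs) all-tt = ∧-tt⁺ (all-tt (here refl)) (⋀-tt⁺ xs (λ j∈ → all-tt (there j∈)))

module Monotonicity (nP : ℕ) (ι : Fin nP → ℕ) (V : Set) (nR : ℕ) (D : Set) (lem : LEM) where
  open Setting nP ι V nR D lem

  InRange : ℕ → ℕ → ℕ → Set
  InRange a b j = a ℕ.≤ j × j ℕ.< b

  ∈-range⁻ : ∀ {a b j} → j ∈ range a b → InRange a b j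
  ∈-range⁻ {a} j∈ = let (j∈upTo , a≤j) = ∈-filter⁻ (a ℕ.≤?_) j∈ in a≤j , ∈-upTo⁻ j∈upTo

  ∈-range⁺ : ∀ {a b j} → InRange a b j → j ∈ range a b
  ∈-range⁺ {a} (a≤j , j<b) = ∈-filter⁺ (a ℕ.≤?_) (∈-upTo⁺ j<b) a≤j

  Entry : Set₁
  Entry = Interval × Letter

  Position : Word → ℕ → Set₁
  Position w i = Σ Entry λ e → at w i ≡ just e

  TimePoint : Word → ℕ → Set₁
  TimePoint w i = Σ Entry λ e → at w i ≡ just e × IsSingleton (proj₁ e)

  Gap : Word → ℕ → Set₁
  Gap w i = Σ Entry λ e → at w i ≡ just e × ¬ IsSingleton (proj₁ e)

  Refines : Entry → Entry → Set₁
  Refines (I , a) (J , b) = (∀ q → mem J q → mem I q) × (a ⊑ˡ b)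

  at⇒< : ∀ w i {e} → at w i ≡ just e → i ℕ.< length w
  at⇒< (x ∷ w) zero _ = s≤s z≤n
  at⇒< (x ∷ w) (suc i) e = s≤s (at⇒< w i e)

  <⇒at : ∀ w i → i ℕ.< length w → Position w i
  <⇒at (x ∷ w) zero _ = x , refl
  <⇒at (x ∷ w) (suc i) (s≤s i<n) = <⇒at w i i<n

  position-≤ : ∀ w {i} → Position w i → ∀ m → m ℕ.≤ i → Position w m
  position-≤ w (_ , eq) m m≤i = <⇒at w m (ℕP.≤-<-trans m≤i (at⇒< w _ eq))

  TimePoint-Gap-disjoint : ∀ {w i} → TimePoint w i → Gap w i → ⊥
  TimePoint-Gap-disjoint (_ , eq , s) (_ , eq′ , ns) with trans (sym eq) eq′
  ... | refl = ns s

  TimePoint-or-Gap : ∀ w i → Position w i → TimePoint w i ⊎ Gap w i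
  TimePoint-or-Gap w i ((I , a) , eq) with lem (IsSingleton I)
  ... | yes s = inj₁ ((I , a) , eq , s)
  ... | no ns = inj₂ ((I , a) , eq , ns)

  tp-not-ff : ∀ w i → tp w i ≢ ff
  tp-not-ff w i e with at w i
  tp-not-ff w i () | nothing
  ... | just (I , a) with lem (IsSingleton I)
  tp-not-ff w i () | just (I , a) | yes _
  tp-not-ff w i () | just (I , a) | no _

  tp-tt⁻ : ∀ w i → tp w i ≡ tt → TimePoint w i
  tp-tt⁻ w i e with at w i
  tp-tt⁻ w i () | nothing
  ... | just (I , a) with lem (IsSingleton I)
  ...   | yes s = (I , a) , refl , s
  tp-tt⁻ w i () | just (I , a) | no _

  tp-tt⁺ : ∀ w i → TimePoint w i → tp w i ≡ tt
  tp-tt⁺ w i ((I , a) , eq , s) with at w i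
  tp-tt⁺ w i ((I , a) , refl , s) | just _ with lem (IsSingleton I)
  ... | yes _ = refl
  ... | no ns = ⊥-elim (ns s)

  ¬tp-not-tt : ∀ w i → ¬ₖ tp w i ≢ tt
  ¬tp-not-tt w i e = tp-not-ff w i (¬-tt⁻ (tp w i) e)

  ¬tp-ff⁻ : ∀ w i → ¬ₖ tp w i ≡ ff → TimePoint w i
  ¬tp-ff⁻ w i e = tp-tt⁻ w i (¬-ff⁻ (tp w i) e)

  guard-tt⁻ : ∀ b {t} → guard b t ≡ tt → t ≡ tt
  guard-tt⁻ true e = e

  guard-tt⁺ : ∀ {b t} → b ≡ true → t ≡ tt → guard b t ≡ tt
  guard-tt⁺ refl e = e

  guard-ff⁻ : ∀ {b t} → guard b t ≡ ff → b ≡ true → t ≡ ff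
  guard-ff⁻ e refl = e

  guard-ff-split : ∀ b {t} → guard b t ≡ ff → b ≡ false ⊎ t ≡ ff
  guard-ff-split true e = inj₂ e
  guard-ff-split false _ = inj₁ refl

  guard-ff⁺ : ∀ b {t} → (b ≡ true → t ≡ ff) → guard b t ≡ ff
  guard-ff⁺ true t-ff = t-ff refl
  guard-ff⁺ false _ = refl

  position-guard : ∀ w {k} → Position w k → (k ℕ.<ᵇ length w) ≡ true
  position-guard w (_ , eq) = Equivalence.to T-≡ (ℕP.<⇒<ᵇ (at⇒< w _ eq))

  guard-position : ∀ w {k} → (k ℕ.<ᵇ length w) ≡ true → Position w k
  guard-position w {k} b = <⇒at w k (ℕP.<ᵇ⇒< k (length w) (Equivalence.from T-≡ b))

  Compatible : Interval → Interval → Interval → Set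
  Compatible A B I = (Σ ℚ λ q → (A ⊖ B) q) × (∀ q → (A ⊖ B) q → mem I q)

  Incompatible : Interval → Interval → Interval → Set
  Incompatible A B I = ∀ q → (A ⊖ B) q → ¬ mem I q

  mcI : Interval → Interval → Interval → TV
  mcI A B I = if does (lem (Compatible A B I)) then tt
              else (if does (lem (Incompatible A B I)) then ff else ⊥v)

  mc-at : ∀ w I i j {A a B b} → at w i ≡ just (A , a) → at w j ≡ just (B , b) →
          mc w I i j ≡ mcI A B I
  mc-at w I i j eqᵢ eqⱼ with at w i | at w j
  mc-at w I i j refl refl | just _ | just _ = refl

  mcI-tt⁻ : ∀ A B I → mcI A B I ≡ tt → Compatible A B I
  mcI-tt⁻ A B I e with lem (Compatible A B I)
  ... | yes c = c
  ... | no _ with lem (Incompatible A B I)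
  mcI-tt⁻ A B I () | no _ | yes _
  mcI-tt⁻ A B I () | no _ | no _

  mcI-tt⁺ : ∀ A B I → Compatible A B I → mcI A B I ≡ tt
  mcI-tt⁺ A B I c with lem (Compatible A B I)
  ... | yes _ = refl
  ... | no nc = ⊥-elim (nc c)

  mcI-ff⁻ : ∀ A B I → mcI A B I ≡ ff → Incompatible A B I
  mcI-ff⁻ A B I e with lem (Compatible A B I)
  mcI-ff⁻ A B I () | yes _
  ... | no _ with lem (Incompatible A B I)
  ...   | yes inc = inc
  mcI-ff⁻ A B I () | no _ | no _

  mcI-ff⁺ : ∀ A B I → Incompatible A B I → mcI A B I ≡ ff
  mcI-ff⁺ A B I inc with lem (Compatible A B I)
  ... | yes ((q , d) , sub) = ⊥-elim (inc q d (sub q d))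
  ... | no _ with lem (Incompatible A B I)
  ...   | yes _ = refl
  ...   | no ninc = ⊥-elim (ninc inc)

  ⊖-mono : ∀ A B A′ B′ → (∀ q → mem A′ q → mem A q) → (∀ q → mem B′ q → mem B q) →
           ∀ q → (A′ ⊖ B′) q → (A ⊖ B) q
  ⊖-mono A B A′ B′ A′⊆A B′⊆B q (0≤q , x , y , x∈ , y∈ , q≡) = 0≤q , x , y , A′⊆A x x∈ , B′⊆B y y∈ , q≡

  mcI-≼ : ∀ A B A′ B′ I → (∀ q → mem A′ q → mem A q) → (∀ q → mem B′ q → mem B q) →
          (Σ ℚ λ q → (A′ ⊖ B′) q) → mcI A B I ≼ mcI A′ B′ I
  mcI-≼ A B A′ B′ I A′⊆A B′⊆B nonempty = keeps
    (λ e → mcI-tt⁺ A′ B′ I (nonempty , λ q d → proj₂ (mcI-tt⁻ A B I e) q (⊖-mono A B A′ B′ A′⊆A B′⊆B q d)))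
    (λ e → mcI-ff⁺ A′ B′ I (λ q d → mcI-ff⁻ A B I e q (⊖-mono A B A′ B′ A′⊆A B′⊆B q d)))

  ≤⇒0≤- : ∀ {x y} → y ℚ.≤ x → 0ℚ ℚ.≤ x - y
  ≤⇒0≤- {x} {y} y≤x = subst (ℚ._≤ x - y) (ℚP.+-inverseʳ y) (ℚP.+-monoˡ-≤ (- y) y≤x)

  <⇒0<- : ∀ {x y} → y ℚ.< x → 0ℚ ℚ.< x - y
  <⇒0<- {x} {y} y<x = subst (ℚ._< x - y) (ℚP.+-inverseʳ y) (ℚP.+-monoˡ-< (- y) y<x)

  -- A later entry is strictly after an earlier one, so no distance is 0:
  -- a constraint I = {0} is violated.
  zero-incompatible : ∀ A B I → IsZeroSet I → (∀ x y → mem A x → mem B y → y ℚ.< x) →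
                      mcI A B I ≡ ff
  zero-incompatible A B I isZero after = mcI-ff⁺ A B I λ where
    q (_ , x , y , x∈ , y∈ , refl) q∈I →
      ℚP.<-irrefl (sym (proj₁ (isZero (x - y)) q∈I)) (<⇒0<- (after x y x∈ y∈))

  notZero-false : ∀ I → notZero I ≡ false → IsZeroSet I
  notZero-false I e with lem (IsZeroSet I)
  ... | yes z = z
  notZero-false I () | no _

  update-⊑ : ∀ {μ ν : Val} {m m′ : Maybe D} x → μ ⊑ᵛ ν → (∀ d → m ≡ just d → m′ ≡ just d) →
             (μ [ x ↦ m ]) ⊑ᵛ (ν [ x ↦ m′ ])
  update-⊑ x μ⊑ν m⊑m′ y d e with lem (x ≡ y)
  ... | yes _ = m⊑m′ d e
  ... | no _ = μ⊑ν y d e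

  valVec-⊑ : ∀ {n} {μ ν : Val} (xs : Vec V n) {ds} → μ ⊑ᵛ ν →
             valVec μ xs ≡ just ds → valVec ν xs ≡ just ds
  valVec-⊑ [] μ⊑ν e = e
  valVec-⊑ {μ = μ} {ν} (x ∷ xs) μ⊑ν e with μ x in eₓ | valVec μ xs in eₓₛ
  valVec-⊑ {μ = μ} {ν} (x ∷ xs) μ⊑ν refl | just d | just ds
    with ν x | μ⊑ν x d eₓ | valVec ν xs | valVec-⊑ xs μ⊑ν eₓₛ
  ... | .(just d) | refl | .(just ds) | refl = refl
  valVec-⊑ (x ∷ xs) μ⊑ν () | just _ | nothing
  valVec-⊑ (x ∷ xs) μ⊑ν () | nothing | _

  holds : Letter → (p : P) → Maybe (Vec D (ι p)) → TV
  holds a p nothing = ⊥v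
  holds a p (just ds) with σ a p
  ... | just S = if does (lem (S ds)) then tt else ff
  ... | nothing = ⊥v

  atom-holds : ∀ w i ν p xs {I a} → at w i ≡ just (I , a) →
               ⟦ Atom p xs ⟧ w i ν ≡ holds a p (valVec ν xs)
  atom-holds w i ν p xs eq with at w i | valVec ν xs
  atom-holds w i ν p xs refl | just (_ , a) | nothing = refl
  atom-holds w i ν p xs refl | just (_ , a) | just ds with σ a p
  ... | just S = refl
  ... | nothing = refl

  holds-≼ : ∀ {a b} p {m m′} → a ⊑ˡ b → (∀ ds → m ≡ just ds → m′ ≡ just ds) →
            holds a p m ≼ holds b p m′
  holds-≼ p {nothing} _ _ = keeps (λ ()) (λ ())
  holds-≼ {a} {b} p {just ds} (σ⊑ , _) m⊑m′ rewrite m⊑m′ ds refl with σ a p in eσ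
  ... | nothing = keeps (λ ()) (λ ())
  ... | just S rewrite σ⊑ p S eσ = keeps (λ e → e) (λ e → e)

  freeze-at : ∀ w i ν r x φ {I a} → at w i ≡ just (I , a) →
              ⟦ Freeze r x φ ⟧ w i ν ≡ ⟦ φ ⟧ w i (ν [ x ↦ ρ a r ])
  freeze-at w i ν r x φ eq with at w i
  freeze-at w i ν r x φ refl | just _ = refl

  -- Well-formed words.

  Before : Entry → Entry → Set
  Before (I , _) (J , _) = ∀ p q → mem I p → mem J q → p ℚ.< q

  IsGapEntry : Entry → Set
  IsGapEntry (I , _) = ¬ IsSingleton I

  NotBothGaps : Entry → Entry → Set
  NotBothGaps e e′ = ¬ (IsGapEntry e × IsGapEntry e′)

  NoMax : Interval → Set
  NoMax I = ∀ x → mem I x → Σ ℚ λ y → mem I y × x ℚ.< y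

  NoPosMin : Interval → Set
  NoPosMin I = ∀ x → mem I x → 0ℚ ℚ.< x → Σ ℚ λ y → mem I y × y ℚ.< x

  -- A proper entry has a nonempty interval, which is open at its finite ends
  -- (other than 0) unless it is a singleton; this keeps the pieces created by
  -- (T1) nonempty.
  Proper : Entry → Set
  Proper (I , _) = Σ ℚ (mem I) × (¬ IsSingleton I → NoMax I × NoPosMin I)

  -- The shape of every observation: entries are proper, strictly ordered in
  -- time, and no two gaps are adjacent.
  WellFormed : Word → Set₁
  WellFormed w = AllPairs Before w × Linked NotBothGaps w × All Proper w

  all-at : ∀ {ℓ} {P : Entry → Set ℓ} w i {e} → All P w → at w i ≡ just e → P e
  all-at (x ∷ w) zero (px ∷ _) refl = px
  all-at (x ∷ w) (suc i) (_ ∷ pw) eq = all-at w i pw eq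

  ordered-at : ∀ w {i j e e′} → AllPairs Before w → i ℕ.< j →
               at w i ≡ just e → at w j ≡ just e′ → Before e e′
  ordered-at (x ∷ w) {zero} {suc j} (x<w ∷ _) _ refl eq = all-at w j x<w eq
  ordered-at (x ∷ w) {suc i} {suc j} (_ ∷ ord) (s≤s i<j) eq eq′ = ordered-at w ord i<j eq eq′

  linked-at : ∀ w i {e e′} → Linked NotBothGaps w → at w i ≡ just e → at w (suc i) ≡ just e′ →
              NotBothGaps e e′
  linked-at (x ∷ y ∷ w) zero (nb ∷ _) refl refl = nb
  linked-at (x ∷ y ∷ w) (suc i) (_ ∷ lk) eq eq′ = linked-at (y ∷ w) i lk eq eq′

  module _ {w : Word} (wf : WellFormed w) where

    nonempty-at : ∀ {i I a} → at w i ≡ just (I , a) → Σ ℚ (mem I)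
    nonempty-at {i} eq = proj₁ (all-at w i (proj₂ (proj₂ wf)) eq)

    before-at : ∀ {i j I a J b} → i ℕ.< j → at w i ≡ just (I , a) → at w j ≡ just (J , b) →
                ∀ p q → mem I p → mem J q → p ℚ.< q
    before-at i<j eq eq′ = ordered-at w (proj₁ wf) i<j eq eq′

    no-adjacent-gaps : ∀ i → Gap w i → Gap w (suc i) → ⊥
    no-adjacent-gaps i (_ , eq , g) (_ , eq′ , g′) = linked-at w i (proj₁ (proj₂ wf)) eq eq′ (g , g′)

  -- Each transformation (T1)–(T3) yields one.
  record Simulation (u v : Word) : Set₁ where
    field
      _~_ : ℕ → ℕ → Set
      related : ∀ {i i′} → i ~ i′ →
                Σ Entry λ e → Σ Entry λ e′ → at u i ≡ just e × at v i′ ≡ just e′ × Refines e e′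
      preimage : ∀ i′ → Position v i′ → Σ ℕ λ i → i ~ i′
      monotone : ∀ {i i′ j j′} → i ~ i′ → j ~ j′ → i ℕ.< j → i′ ℕ.< j′
      image : ∀ i → TimePoint u i → Σ ℕ λ i′ → i ~ i′
      image-unique : ∀ {i i′ j′} → TimePoint u i → i ~ i′ → i ~ j′ → i′ ≡ j′

  module SimulationFacts {u v : Word} (S : Simulation u v) (wf-v : WellFormed v) where
    open Simulation S

    position-v : ∀ {i i′} → i ~ i′ → Position v i′
    position-v r = let (_ , e′ , _ , eq′ , _) = related r in e′ , eq′

    position-u : ∀ {i i′} → i ~ i′ → Position u i
    position-u r = let (e , _ , eq , _) = related r in e , eq

    position-v-≤ : ∀ {i i′} k′ → i ~ i′ → k′ ℕ.≤ i′ → Position v k′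
    position-v-≤ k′ r = position-≤ v (position-v r) k′

    -- a refinement of a singleton with nonempty interval is the same singleton
    timepoint-image : ∀ {i i′} → i ~ i′ → TimePoint u i → TimePoint v i′
    timepoint-image {i′ = i′} r ((I₀ , _) , eq₀ , (τ , τ∈I , unique)) with related r
    ... | (I , a) , (J , b) , eq , eq′ , (J⊆I , _) with trans (sym eq₀) eq
    ... | refl = let (x , x∈J) = nonempty-at wf-v eq′ in
      (J , b) , eq′ , x , x∈J , λ q q∈J → trans (unique q (J⊆I q q∈J)) (sym (unique x (J⊆I x x∈J)))

    reflect-≤ : ∀ {k k′ i i′} → k ~ k′ → i ~ i′ → k′ ℕ.≤ i′ → k ℕ.≤ i
    reflect-≤ {k} {k′} {i} rk ri k′≤i′ with ℕP.<-cmp k i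
    ... | tri< k<i _ _ = ℕP.<⇒≤ k<i
    ... | tri≈ _ refl _ = ℕP.≤-refl
    ... | tri> _ _ i<k = ⊥-elim (ℕP.<⇒≱ (monotone ri rk i<k) k′≤i′)

    preserve-≤ : ∀ {k k′ i i′} → k ~ k′ → i ~ i′ → k ℕ.≤ i → TimePoint u k ⊎ TimePoint u i →
                 k′ ℕ.≤ i′
    preserve-≤ rk ri k≤i timepoint with ℕP.m≤n⇒m<n∨m≡n k≤i
    ... | inj₁ k<i = ℕP.<⇒≤ (monotone rk ri k<i)
    preserve-≤ rk ri k≤i (inj₁ tk) | inj₂ refl = ℕP.≤-reflexive (image-unique tk rk ri)
    preserve-≤ rk ri k≤i (inj₂ ti) | inj₂ refl = ℕP.≤-reflexive (image-unique ti rk ri)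

    reflect-< : ∀ {k k′ i i′} → k ~ k′ → i ~ i′ → k′ ℕ.< i′ → TimePoint u k ⊎ TimePoint u i →
                k ℕ.< i
    reflect-< rk ri k′<i′ timepoint with ℕP.m≤n⇒m<n∨m≡n (reflect-≤ rk ri (ℕP.<⇒≤ k′<i′))
    ... | inj₁ k<i = k<i
    reflect-< rk ri k′<i′ (inj₁ tk) | inj₂ refl = ⊥-elim (ℕP.<-irrefl (image-unique tk rk ri) k′<i′)
    reflect-< rk ri k′<i′ (inj₂ ti) | inj₂ refl = ⊥-elim (ℕP.<-irrefl (image-unique ti rk ri) k′<i′)

    consecutive : ∀ {k k′ m′} → k ~ k′ → suc k ~ m′ → TimePoint u k → TimePoint u (suc k) →
                  m′ ≡ suc k′
    consecutive {k} {k′} {m′} rk rm tk tm with ℕP.<-cmp m′ (suc k′)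
    ... | tri≈ _ eq _ = eq
    ... | tri< m′<sk′ _ _ = ⊥-elim (ℕP.<⇒≱ (monotone rk rm ℕP.≤-refl) (ℕP.≤-pred m′<sk′))
    ... | tri> _ _ sk′<m′ with preimage (suc k′) (position-v-≤ (suc k′) rm (ℕP.<⇒≤ sk′<m′))
    ...   | n , rn = ⊥-elim (ℕP.<⇒≱ (reflect-< rk rn ℕP.≤-refl (inj₁ tk))
                                   (ℕP.≤-pred (reflect-< rn rm sk′<m′ (inj₂ tm))))

    tp-≼ : ∀ {i i′} → i ~ i′ → tp u i ≼ tp v i′
    tp-≼ {i} {i′} r = keeps
      (λ e → tp-tt⁺ v i′ (timepoint-image r (tp-tt⁻ u i e)))
      (λ e → ⊥-elim (tp-not-ff u i e))

    -- distances between images are distances between the original intervals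
    mc-≼ : ∀ I {a a′ b b′} → a ~ a′ → b ~ b′ → b′ ℕ.≤ a′ → mc u I a b ≼ mc v I a′ b′
    mc-≼ I {a} {a′} {b} {b′} ra rb b′≤a′ with related ra | related rb
    ... | (A , _) , (A′ , _) , ea , ea′ , (A′⊆A , _) | (B , _) , (B′ , _) , eb , eb′ , (B′⊆B , _)
      rewrite mc-at u I a b ea eb | mc-at v I a′ b′ ea′ eb′ =
        mcI-≼ A B A′ B′ I A′⊆A B′⊆B distance
      where
      distance : Σ ℚ λ q → (A′ ⊖ B′) q
      distance with nonempty-at wf-v ea′ | nonempty-at wf-v eb′ | ℕP.m≤n⇒m<n∨m≡n b′≤a′
      ... | x , x∈A′ | y , y∈B′ | inj₁ b′<a′ =
            x - y , ≤⇒0≤- (ℚP.<⇒≤ (before-at wf-v b′<a′ eb′ ea′ y x y∈B′ x∈A′)) , x , y , x∈A′ , y∈B′ , refl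
      ... | x , x∈A′ | _ | inj₂ refl with trans (sym ea′) eb′
      ...   | refl = x - x , ≤⇒0≤- {x} {x} ℚP.≤-refl , x , x , x∈A′ , x∈A′ , refl

    mc-zero : ∀ I → notZero I ≡ false → ∀ {a′ b′} → b′ ℕ.< a′ → Position v a′ → Position v b′ →
              mc v I a′ b′ ≡ ff
    mc-zero I nz {a′} {b′} b′<a′ ((A , _) , ea) ((B , _) , eb) rewrite mc-at v I a′ b′ ea eb =
      zero-incompatible A B I (notZero-false I nz) (λ x y x∈A y∈B → before-at wf-v b′<a′ eb ea y x y∈B x∈A)

  module Along {u v : Word} (S : Simulation u v) (wf-u : WellFormed u) (wf-v : WellFormed v) where
    open Simulation S
    open SimulationFacts S wf-v

    -- v-positions separated only by gaps stem from u-positions at distance at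
    -- most two, and at distance two only across a gap: in u, too, only gaps lie
    -- in between, and u has no two adjacent gaps.
    gap-bridged : ∀ {a a′ b b′} → a ~ a′ → b ~ b′ → a′ ℕ.< b′ →
                  (∀ m′ → a′ ℕ.< m′ → m′ ℕ.< b′ → Gap v m′) →
                  a ≡ b ⊎ suc a ≡ b ⊎ (suc (suc a) ≡ b × Gap u (suc a))
    gap-bridged {a} {a′} {b} {b′} ra rb a′<b′ gaps-v = split (reflect-≤ ra rb (ℕP.<⇒≤ a′<b′))
      where
      gaps-u : ∀ m → a ℕ.< m → m ℕ.< b → Gap u m
      gaps-u m a<m m<b with TimePoint-or-Gap u m (position-≤ u (position-u rb) m (ℕP.<⇒≤ m<b))
      ... | inj₂ g = g
      ... | inj₁ tm = let (m′ , rm) = image m tm in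
        ⊥-elim (TimePoint-Gap-disjoint {v} {m′} (timepoint-image rm tm)
                  (gaps-v m′ (monotone ra rm a<m) (monotone rm rb m<b)))
      split : a ℕ.≤ b → a ≡ b ⊎ suc a ≡ b ⊎ (suc (suc a) ≡ b × Gap u (suc a))
      split a≤b with ℕP.m≤n⇒m<n∨m≡n a≤b
      ... | inj₂ a≡b = inj₁ a≡b
      ... | inj₁ a<b with ℕP.m≤n⇒m<n∨m≡n a<b
      ...   | inj₂ sa≡b = inj₂ (inj₁ sa≡b)
      ...   | inj₁ sa<b with ℕP.m≤n⇒m<n∨m≡n sa<b
      ...     | inj₂ ssa≡b = inj₂ (inj₂ (ssa≡b , gaps-u (suc a) ℕP.≤-refl sa<b))
      ...     | inj₁ ssa<b = ⊥-elim (no-adjacent-gaps wf-u (suc a)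
                                       (gaps-u (suc a) ℕP.≤-refl (ℕP.<-trans (ℕP.n<1+n (suc a)) ssa<b))
                                       (gaps-u (suc (suc a)) (ℕP.m<n⇒m<1+n (ℕP.n<1+n a)) ssa<b))

    Covered : ℕ → ℕ → ℕ → ℕ → Set
    Covered a b a′ b′ = ∀ k′ → InRange a′ b′ k′ → Σ ℕ λ k → k ~ k′ × InRange a b k

    Contained : ℕ → ℕ → ℕ → ℕ → Set₁
    Contained a b a′ b′ = ∀ k → TimePoint u k → InRange a b k → Σ ℕ λ k′ → k ~ k′ × InRange a′ b′ k′

    module _ {f g : ℕ → TV} {a b a′ b′ : ℕ} where

      ⋁-≼ : Covered a b a′ b′ → Contained a b a′ b′ →
            (∀ {j j′} → j ~ j′ → InRange a b j → InRange a′ b′ j′ → f j ≼ g j′) →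
            (∀ j → f j ≡ tt → TimePoint u j) →
            ⋁ (map f (range a b)) ≼ ⋁ (map g (range a′ b′))
      ⋁-≼ covered contained f≼g tt-at-timepoint = keeps keep-tt keep-ff
        where
        keep-tt : ⋁ (map f (range a b)) ≡ tt → ⋁ (map g (range a′ b′)) ≡ tt
        keep-tt e =
          let (j , j∈ , fj) = ⋁-tt⁻ f (range a b) e
              j-in = ∈-range⁻ j∈
              (j′ , rj , j′-in) = contained j (tt-at-timepoint j fj) j-in
          in ⋁-tt⁺ g (range a′ b′) (∈-range⁺ j′-in) (keeps-tt (f≼g rj j-in j′-in) fj)
        keep-ff : ⋁ (map f (range a b)) ≡ ff → ⋁ (map g (range a′ b′)) ≡ ff
        keep-ff e = ⋁-ff⁺ g (range a′ b′) λ j′∈ →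
          let j′-in = ∈-range⁻ j′∈
              (j , rj , j-in) = covered _ j′-in
          in keeps-ff (f≼g rj j-in j′-in) (⋁-ff⁻ f (range a b) e (∈-range⁺ j-in))

      ⋀-keeps-tt : Covered a b a′ b′ →
                   (∀ {j j′} → j ~ j′ → InRange a b j → InRange a′ b′ j′ → f j ≼ g j′) →
                   ⋀ (map f (range a b)) ≡ tt → ⋀ (map g (range a′ b′)) ≡ tt
      ⋀-keeps-tt covered f≼g e = ⋀-tt⁺ g (range a′ b′) λ j′∈ →
        let j′-in = ∈-range⁻ j′∈
            (j , rj , j-in) = covered _ j′-in
        in keeps-tt (f≼g rj j-in j′-in) (⋀-tt⁻ f (range a b) e (∈-range⁺ j-in))

      ⋀-keeps-ff : Contained a b a′ b′ →
                   (∀ {j j′} → j ~ j′ → InRange a b j → InRange a′ b′ j′ → f j ≼ g j′) →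
                   (∀ j → f j ≡ ff → TimePoint u j) →
                   ⋀ (map f (range a b)) ≡ ff → ⋀ (map g (range a′ b′)) ≡ ff
      ⋀-keeps-ff contained f≼g ff-at-timepoint e =
        let (j , j∈ , fj) = ⋀-ff⁻ f (range a b) e
            j-in = ∈-range⁻ j∈
            (j′ , rj , j′-in) = contained j (ff-at-timepoint j fj) j-in
        in ⋀-ff⁺ g (range a′ b′) (∈-range⁺ j′-in) (keeps-ff (f≼g rj j-in j′-in) fj)

    covered-upto : ∀ {i i′} → i ~ i′ → Covered 0 (suc i) 0 (suc i′)
    covered-upto ri k′ (_ , k′<si′) =
      let (k , rk) = preimage k′ (position-v-≤ k′ ri (ℕP.≤-pred k′<si′)) in
      k , rk , z≤n , s≤s (reflect-≤ rk ri (ℕP.≤-pred k′<si′))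

    contained-upto : ∀ {i i′} → i ~ i′ → Contained 0 (suc i) 0 (suc i′)
    contained-upto ri k tk (_ , k<si) =
      let (k′ , rk) = image k tk in
      k′ , rk , z≤n , s≤s (preserve-≤ rk ri (ℕP.≤-pred k<si) (inj₁ tk))

    covered-from : ∀ {i i′} → i ~ i′ → Covered i (length u) i′ (length v)
    covered-from ri k′ (i′≤k′ , k′<n) =
      let (k , rk) = preimage k′ (<⇒at v k′ k′<n) in
      k , rk , reflect-≤ ri rk i′≤k′ , at⇒< u k (proj₂ (position-u rk))

    contained-from : ∀ {i i′} → i ~ i′ → Contained i (length u) i′ (length v)
    contained-from ri k tk (i≤k , _) =
      let (k′ , rk) = image k tk in
      k′ , rk , preserve-≤ ri rk i≤k (inj₂ tk) , at⇒< v k′ (proj₂ (position-v rk))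

    -- (j, i] for S; the lower end needs j to be a time point
    covered-since : ∀ {j j′ i i′} → j ~ j′ → i ~ i′ → TimePoint u j →
                    Covered (suc j) (suc i) (suc j′) (suc i′)
    covered-since rj ri tj k′ (j′<k′ , k′<si′) =
      let (k , rk) = preimage k′ (position-v-≤ k′ ri (ℕP.≤-pred k′<si′)) in
      k , rk , reflect-< rj rk j′<k′ (inj₁ tj) , s≤s (reflect-≤ rk ri (ℕP.≤-pred k′<si′))

    contained-since : ∀ {j j′ i i′} → j ~ j′ → i ~ i′ → Contained (suc j) (suc i) (suc j′) (suc i′)
    contained-since rj ri k tk (j<k , k<si) =
      let (k′ , rk) = image k tk in
      k′ , rk , monotone rj rk j<k , s≤s (preserve-≤ rk ri (ℕP.≤-pred k<si) (inj₁ tk))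

    -- [i, j) for U; the upper end needs j to be a time point
    covered-until : ∀ {i i′ j j′} → i ~ i′ → j ~ j′ → TimePoint u j → Covered i j i′ j′
    covered-until ri rj tj k′ (i′≤k′ , k′<j′) =
      let (k , rk) = preimage k′ (position-v-≤ k′ rj (ℕP.<⇒≤ k′<j′)) in
      k , rk , reflect-≤ ri rk i′≤k′ , reflect-< rk rj k′<j′ (inj₂ tj)

    contained-until : ∀ {i i′ j j′} → i ~ i′ → j ~ j′ → Contained i j i′ j′
    contained-until ri rj k tk (i≤k , k<j) =
      let (k′ , rk) = image k tk in
      k′ , rk , preserve-≤ ri rk i≤k (inj₂ tk) , monotone rk rj k<j

    module Temporal (I : Interval) (φ ψ : Formula) {μ ν : Val}
                    (φ-≼ : ∀ {k k′} → k ~ k′ → ⟦ φ ⟧ u k μ ≼ ⟦ φ ⟧ v k′ ν)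
                    (ψ-≼ : ∀ {k k′} → k ~ k′ → ⟦ ψ ⟧ u k μ ≼ ⟦ ψ ⟧ v k′ ν) where

      Window : Word → Val → ℕ → ℕ → TV
      Window w ν a b = ⋀ (map (λ k → tp w k →ₖ ⟦ φ ⟧ w k ν) (range a b))

      guarded-ff⁻ : ∀ w k {x} → (tp w k →ₖ x) ≡ ff → TimePoint w k
      guarded-ff⁻ w k e = ¬tp-ff⁻ w k (proj₁ (∨-ff⁻ _ _ e))

      window-keeps-tt : ∀ {a b a′ b′} → Covered a b a′ b′ → Window u μ a b ≡ tt → Window v ν a′ b′ ≡ tt
      window-keeps-tt covered = ⋀-keeps-tt covered (λ rk _ _ → ≼-→ (tp-≼ rk) (φ-≼ rk))

      window-keeps-ff : ∀ {a b a′ b′} → Contained a b a′ b′ → Window u μ a b ≡ ff → Window v ν a′ b′ ≡ ff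
      window-keeps-ff contained =
        ⋀-keeps-ff contained (λ rk _ _ → ≼-→ (tp-≼ rk) (φ-≼ rk)) (λ k → guarded-ff⁻ u k)

      term-tt⁻ : ∀ w j {c} → tp w j ∧ₖ c ≡ tt → TimePoint w j
      term-tt⁻ w j e = tp-tt⁻ w j (proj₁ (∧-tt⁻ _ _ e))

      -- The window only
      -- needs to be covered when the term is true, i.e. when j is a time point.
      term-≼ : ∀ {j j′ m m′ a b a′ b′} → j ~ j′ → m ≼ m′ →
               (TimePoint u j → Covered a b a′ b′) → Contained a b a′ b′ →
               (tp u j ∧ₖ m ∧ₖ ⟦ ψ ⟧ u j μ ∧ₖ Window u μ a b) ≼
               (tp v j′ ∧ₖ m′ ∧ₖ ⟦ ψ ⟧ v j′ ν ∧ₖ Window v ν a′ b′)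
      term-≼ {j} {j′} {m} {m′} {a} {b} {a′} {b′} rj m≼m′ covered contained = keeps keep-tt keep-ff
        where
        keep-tt : tp u j ∧ₖ m ∧ₖ ⟦ ψ ⟧ u j μ ∧ₖ Window u μ a b ≡ tt →
                  tp v j′ ∧ₖ m′ ∧ₖ ⟦ ψ ⟧ v j′ ν ∧ₖ Window v ν a′ b′ ≡ tt
        keep-tt e = ∧-keeps-tt (keeps-tt (tp-≼ rj)) (∧-keeps-tt (keeps-tt m≼m′)
                      (∧-keeps-tt (keeps-tt (ψ-≼ rj)) (window-keeps-tt (covered (term-tt⁻ u j e))))) e
        keep-ff : tp u j ∧ₖ m ∧ₖ ⟦ ψ ⟧ u j μ ∧ₖ Window u μ a b ≡ ff →
                  tp v j′ ∧ₖ m′ ∧ₖ ⟦ ψ ⟧ v j′ ν ∧ₖ Window v ν a′ b′ ≡ ff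
        keep-ff = ∧-keeps-ff (keeps-ff (tp-≼ rj)) (∧-keeps-ff (keeps-ff m≼m′)
                    (∧-keeps-ff (keeps-ff (ψ-≼ rj)) (window-keeps-ff contained)))

      since-≼ : ∀ {i i′} → i ~ i′ → ⟦ Since I φ ψ ⟧ u i μ ≼ ⟦ Since I φ ψ ⟧ v i′ ν
      since-≼ {i} {i′} ri = ⋁-≼ (covered-upto ri) (contained-upto ri) term (λ j → term-tt⁻ u j)
        where
        term : ∀ {j j′} → j ~ j′ → InRange 0 (suc i) j → InRange 0 (suc i′) j′ →
               (tp u j ∧ₖ mc u I i j ∧ₖ ⟦ ψ ⟧ u j μ ∧ₖ Window u μ (suc j) (suc i)) ≼
               (tp v j′ ∧ₖ mc v I i′ j′ ∧ₖ ⟦ ψ ⟧ v j′ ν ∧ₖ Window v ν (suc j′) (suc i′))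
        term rj _ (_ , j′<si′) = term-≼ rj (mc-≼ I ri rj (ℕP.≤-pred j′<si′))
                                   (covered-since rj ri) (contained-since rj ri)

      until-≼ : ∀ {i i′} → i ~ i′ → ⟦ Until I φ ψ ⟧ u i μ ≼ ⟦ Until I φ ψ ⟧ v i′ ν
      until-≼ {i} {i′} ri = ⋁-≼ (covered-from ri) (contained-from ri) term (λ j → term-tt⁻ u j)
        where
        term : ∀ {j j′} → j ~ j′ → InRange i (length u) j → InRange i′ (length v) j′ →
               (tp u j ∧ₖ mc u I j i ∧ₖ ⟦ ψ ⟧ u j μ ∧ₖ Window u μ i j) ≼
               (tp v j′ ∧ₖ mc v I j′ i′ ∧ₖ ⟦ ψ ⟧ v j′ ν ∧ₖ Window v ν i′ j′)
        term rj _ (i′≤j′ , _) = term-≼ rj (mc-≼ I rj ri i′≤j′)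
                                  (covered-until ri rj) (contained-until ri rj)

    module NextPrev (I : Interval) (φ : Formula) {μ ν : Val}
                    (φ-≼ : ∀ {k k′} → k ~ k′ → ⟦ φ ⟧ u k μ ≼ ⟦ φ ⟧ v k′ ν) where

      -- The bodies of the disjuncts of ∘_I φ and •_I φ: φ at the target t,
      -- the metric constraint on the distance from lo to hi, and either "t and
      -- s are time points" (c₁, c₋₁) or "m is not a time point" (c₀, c₂, c₋₂).
      adjacent : Word → Val → (hi lo t s : ℕ) → TV
      adjacent w ν hi lo t s = mc w I hi lo ∧ₖ ⟦ φ ⟧ w t ν ∧ₖ tp w t ∧ₖ tp w s

      across : Word → Val → (hi lo t m : ℕ) → TV
      across w ν hi lo t m = mc w I hi lo ∧ₖ ⟦ φ ⟧ w t ν ∧ₖ ¬ₖ tp w m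

      -- ⟦ ∘_I φ ⟧ w i ν is stay ∨ next₁ ∨ next₂, and ⟦ •_I φ ⟧ w i ν is stay ∨ prev₁ ∨ prev₂
      stay next₁ next₂ prev₁ prev₂ : Word → Val → ℕ → TV
      stay w ν i = guard (notZero I) (across w ν i i i i)
      next₁ w ν i = guard (suc i ℕ.<ᵇ length w) (adjacent w ν (suc i) i (suc i) i)
      next₂ w ν i = guard (suc (suc i) ℕ.<ᵇ length w) (across w ν (suc (suc i)) i (suc (suc i)) (suc i))
      prev₁ w ν i = guard (1 ℕ.≤ᵇ i) (adjacent w ν i (i ℕ.∸ 1) (i ℕ.∸ 1) i)
      prev₂ w ν i = guard (2 ℕ.≤ᵇ i) (across w ν i (i ℕ.∸ 2) (i ℕ.∸ 2) (i ℕ.∸ 1))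

      Blocked : Word → Val → (hi lo t : ℕ) → Set
      Blocked w ν hi lo t = mc w I hi lo ≡ ff ⊎ ⟦ φ ⟧ w t ν ≡ ff

      blocked-kills : ∀ {w ν hi lo t} c → Blocked w ν hi lo t → mc w I hi lo ∧ₖ ⟦ φ ⟧ w t ν ∧ₖ c ≡ ff
      blocked-kills {w} {ν} {hi} {lo} {t} c (inj₁ m) = ∧-ff⁺ (mc w I hi lo) _ (inj₁ m)
      blocked-kills {w} {ν} {hi} {lo} {t} c (inj₂ p) =
        ∧-ff⁺ (mc w I hi lo) _ (inj₂ (∧-ff⁺ (⟦ φ ⟧ w t ν) c (inj₁ p)))

      blocked-transfer : ∀ {hi hi′ lo lo′ t t′} → hi ~ hi′ → lo ~ lo′ → t ~ t′ → lo′ ℕ.≤ hi′ →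
                         Blocked u μ hi lo t → Blocked v ν hi′ lo′ t′
      blocked-transfer rh rl rt lo′≤hi′ (inj₁ m) = inj₁ (keeps-ff (mc-≼ I rh rl lo′≤hi′) m)
      blocked-transfer rh rl rt lo′≤hi′ (inj₂ p) = inj₂ (keeps-ff (φ-≼ rt) p)

      adjacent-≼ : ∀ {hi hi′ lo lo′ t t′ s s′} → hi ~ hi′ → lo ~ lo′ → t ~ t′ → s ~ s′ → lo′ ℕ.≤ hi′ →
                   adjacent u μ hi lo t s ≼ adjacent v ν hi′ lo′ t′ s′
      adjacent-≼ rh rl rt rs lo′≤hi′ = ≼-∧ (mc-≼ I rh rl lo′≤hi′) (≼-∧ (φ-≼ rt) (≼-∧ (tp-≼ rt) (tp-≼ rs)))

      adjacent-tt⁻ : ∀ w ν hi lo t s → adjacent w ν hi lo t s ≡ tt → TimePoint w t × TimePoint w s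
      adjacent-tt⁻ w ν hi lo t s e =
        let (tp-t , tp-s) = ∧-tt⁻ (tp w t) (tp w s)
                              (proj₂ (∧-tt⁻ (⟦ φ ⟧ w t ν) _ (proj₂ (∧-tt⁻ (mc w I hi lo) _ e)))) in
        tp-tt⁻ w t tp-t , tp-tt⁻ w s tp-s

      adjacent-ff⁻ : ∀ w ν hi lo t s → adjacent w ν hi lo t s ≡ ff → Blocked w ν hi lo t
      adjacent-ff⁻ w ν hi lo t s e with ∧-ff⁻ (mc w I hi lo) _ e
      ... | inj₁ m = inj₁ m
      ... | inj₂ e′ with ∧-ff⁻ (⟦ φ ⟧ w t ν) _ e′
      ...   | inj₁ p = inj₂ p
      ...   | inj₂ e″ with ∧-ff⁻ (tp w t) (tp w s) e″
      ...     | inj₁ tp-t = ⊥-elim (tp-not-ff w t tp-t)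
      ...     | inj₂ tp-s = ⊥-elim (tp-not-ff w s tp-s)

      across-not-tt : ∀ w ν hi lo t m → across w ν hi lo t m ≢ tt
      across-not-tt w ν hi lo t m e =
        ¬tp-not-tt w m (proj₂ (∧-tt⁻ (⟦ φ ⟧ w t ν) _ (proj₂ (∧-tt⁻ (mc w I hi lo) _ e))))

      across-ff⁻ : ∀ w ν hi lo t m → across w ν hi lo t m ≡ ff → Blocked w ν hi lo t ⊎ TimePoint w m
      across-ff⁻ w ν hi lo t m e with ∧-ff⁻ (mc w I hi lo) _ e
      ... | inj₁ mc-ff = inj₁ (inj₁ mc-ff)
      ... | inj₂ e′ with ∧-ff⁻ (⟦ φ ⟧ w t ν) _ e′
      ...   | inj₁ p = inj₁ (inj₂ p)
      ...   | inj₂ ¬tp-ff = inj₂ (¬tp-ff⁻ w m ¬tp-ff)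

      timepoint-across : ∀ w ν hi lo t m → TimePoint w m → across w ν hi lo t m ≡ ff
      timepoint-across w ν hi lo t m tm =
        ∧-ff⁺ (mc w I hi lo) _ (inj₂ (∧-ff⁺ (⟦ φ ⟧ w t ν) _ (inj₂ (¬-ff⁺ (tp-tt⁺ w m tm)))))

      -- Why c₀ is false in u at i.
      StayExcluded : ℕ → Set₁
      StayExcluded i = notZero I ≡ false ⊎ Blocked u μ i i i ⊎ TimePoint u i

      stay-ff⁻ : ∀ {i} → stay u μ i ≡ ff → StayExcluded i
      stay-ff⁻ {i} e with guard-ff-split (notZero I) e
      ... | inj₁ nz = inj₁ nz
      ... | inj₂ e′ with across-ff⁻ u μ i i i i e′
      ...   | inj₁ b = inj₂ (inj₁ b)
      ...   | inj₂ t = inj₂ (inj₂ t)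

      stay-excluded-v : ∀ {i i′} → i ~ i′ → StayExcluded i → stay v ν i′ ≡ ff
      stay-excluded-v {i′ = i′} ri excluded = guard-ff⁺ (notZero I) (λ nz → body nz excluded)
        where
        body : notZero I ≡ true → StayExcluded _ → across v ν i′ i′ i′ i′ ≡ ff
        body nz (inj₁ nz′) with trans (sym nz) nz′
        ... | ()
        body _ (inj₂ (inj₁ b)) = blocked-kills _ (blocked-transfer ri ri ri ℕP.≤-refl b)
        body _ (inj₂ (inj₂ t)) = timepoint-across v ν i′ i′ i′ i′ (timepoint-image ri t)

      stay-spread : ∀ {i a′ b′} → StayExcluded i → i ~ a′ → i ~ b′ → a′ ℕ.< b′ →
                    mc v I b′ a′ ≡ ff ⊎ (⟦ φ ⟧ v a′ ν ≡ ff × ⟦ φ ⟧ v b′ ν ≡ ff)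
      stay-spread (inj₁ nz) ra rb a′<b′ = inj₁ (mc-zero I nz a′<b′ (position-v rb) (position-v ra))
      stay-spread (inj₂ (inj₁ (inj₁ m))) ra rb a′<b′ = inj₁ (keeps-ff (mc-≼ I rb ra (ℕP.<⇒≤ a′<b′)) m)
      stay-spread (inj₂ (inj₁ (inj₂ p))) ra rb _ = inj₂ (keeps-ff (φ-≼ ra) p , keeps-ff (φ-≼ rb) p)
      stay-spread (inj₂ (inj₂ t)) ra rb a′<b′ = ⊥-elim (ℕP.<-irrefl (image-unique t ra rb) a′<b′)

      GapsBetween : ℕ → ℕ → Set₁
      GapsBetween a′ b′ = ∀ m′ → a′ ℕ.< m′ → m′ ℕ.< b′ → Gap v m′

      nothing-between : ∀ a′ → GapsBetween a′ (suc a′)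
      nothing-between a′ m′ a′<m′ m′<sa′ = ⊥-elim (ℕP.<⇒≱ a′<m′ (ℕP.≤-pred m′<sa′))

      one-gap-between : ∀ a′ → Gap v (suc a′) → GapsBetween a′ (suc (suc a′))
      one-gap-between a′ g m′ a′<m′ m′<ssa′ =
        subst (Gap v) (ℕP.≤-antisym a′<m′ (ℕP.≤-pred m′<ssa′)) g

      -- If c₀, c₁, c₂ of ∘_I φ are false in u at i, then every candidate
      -- successor p′ of i′ in v (reached across gaps only) is blocked: its
      -- preimage is i, i+1, or i+2 reached across a gap.
      next-blocked : ∀ {i i′} → i ~ i′ → StayExcluded i →
                     (Position u (suc i) → Blocked u μ (suc i) i (suc i)) →
                     (Position u (suc (suc i)) →
                        Blocked u μ (suc (suc i)) i (suc (suc i)) ⊎ TimePoint u (suc i)) →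
                     ∀ p′ → i′ ℕ.< p′ → Position v p′ → GapsBetween i′ p′ → Blocked v ν p′ i′ p′
      next-blocked ri excluded next₁-blocked next₂-blocked p′ i′<p′ pos gaps with preimage p′ pos
      ... | k , rk with gap-bridged ri rk i′<p′ gaps
      ...   | inj₁ refl = ⊎-map₂ proj₂ (stay-spread excluded ri rk i′<p′)
      ...   | inj₂ (inj₁ refl) = blocked-transfer rk ri rk (ℕP.<⇒≤ i′<p′) (next₁-blocked (position-u rk))
      ...   | inj₂ (inj₂ (refl , g)) with next₂-blocked (position-u rk)
      ...     | inj₁ b = blocked-transfer rk ri rk (ℕP.<⇒≤ i′<p′) b
      ...     | inj₂ t = ⊥-elim (TimePoint-Gap-disjoint {u} t g)

      prev-blocked : ∀ {i i′} → i ~ i′ → StayExcluded i →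
                     (∀ k → suc k ≡ i → Blocked u μ i k k) →
                     (∀ k → suc (suc k) ≡ i → Blocked u μ i k k ⊎ TimePoint u (suc k)) →
                     ∀ p′ → p′ ℕ.< i′ → GapsBetween p′ i′ → Blocked v ν i′ p′ p′
      prev-blocked ri excluded prev₁-blocked prev₂-blocked p′ p′<i′ gaps
        with preimage p′ (position-v-≤ p′ ri (ℕP.<⇒≤ p′<i′))
      ... | k , rk with gap-bridged rk ri p′<i′ gaps
      ...   | inj₁ refl = ⊎-map₂ proj₁ (stay-spread excluded rk ri p′<i′)
      ...   | inj₂ (inj₁ sk≡i) = blocked-transfer ri rk rk (ℕP.<⇒≤ p′<i′) (prev₁-blocked k sk≡i)
      ...   | inj₂ (inj₂ (ssk≡i , g)) with prev₂-blocked k ssk≡i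
      ...     | inj₁ b = blocked-transfer ri rk rk (ℕP.<⇒≤ p′<i′) b
      ...     | inj₂ t = ⊥-elim (TimePoint-Gap-disjoint {u} t g)

      -- c₁ is true only at consecutive time points, whose images are consecutive
      next₁-keeps-tt : ∀ {i i′} → i ~ i′ → next₁ u μ i ≡ tt → next₁ v ν i′ ≡ tt
      next₁-keeps-tt {i} {i′} ri n₁ with guard-tt⁻ (suc i ℕ.<ᵇ length u) n₁
      ... | body with adjacent-tt⁻ u μ (suc i) i (suc i) i body
      ...   | tsi , ti with image (suc i) tsi
      ...     | k′ , rk with consecutive ri rk ti tsi
      ...       | refl = guard-tt⁺ (position-guard v (position-v rk))
                           (keeps-tt (adjacent-≼ rk ri rk ri (ℕP.n≤1+n i′)) body)

      -- c₀ and c₂ are never true, so ∘_I φ is true only through c₁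
      next-keeps-tt : ∀ {i i′} → i ~ i′ → ⟦ Next I φ ⟧ u i μ ≡ tt → ⟦ Next I φ ⟧ v i′ ν ≡ tt
      next-keeps-tt {i} {i′} ri e with ∨-tt⁻ (stay u μ i) _ e
      ... | inj₁ s = ⊥-elim (across-not-tt u μ i i i i (guard-tt⁻ (notZero I) s))
      ... | inj₂ e′ with ∨-tt⁻ (next₁ u μ i) _ e′
      ...   | inj₁ n₁ = ∨-tt⁺ (stay v ν i′) _ (inj₂ (∨-tt⁺ (next₁ v ν i′) _ (inj₁ (next₁-keeps-tt ri n₁))))
      ...   | inj₂ n₂ = ⊥-elim (across-not-tt u μ _ _ _ _ (guard-tt⁻ (suc (suc i) ℕ.<ᵇ length u) n₂))

      next-keeps-ff : ∀ {i i′} → i ~ i′ → ⟦ Next I φ ⟧ u i μ ≡ ff → ⟦ Next I φ ⟧ v i′ ν ≡ ff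
      next-keeps-ff {i} {i′} ri e =
        ∨-ff⁺ (stay-excluded-v ri excluded) (∨-ff⁺ (guard-ff⁺ _ next₁-v) (guard-ff⁺ _ next₂-v))
        where
        stay-ff : stay u μ i ≡ ff
        stay-ff = proj₁ (∨-ff⁻ (stay u μ i) _ e)
        next₁-ff : next₁ u μ i ≡ ff
        next₁-ff = proj₁ (∨-ff⁻ (next₁ u μ i) _ (proj₂ (∨-ff⁻ (stay u μ i) _ e)))
        next₂-ff : next₂ u μ i ≡ ff
        next₂-ff = proj₂ (∨-ff⁻ (next₁ u μ i) _ (proj₂ (∨-ff⁻ (stay u μ i) _ e)))
        excluded : StayExcluded i
        excluded = stay-ff⁻ stay-ff
        blocked : ∀ p′ → i′ ℕ.< p′ → Position v p′ → GapsBetween i′ p′ → Blocked v ν p′ i′ p′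
        blocked = next-blocked ri excluded
          (λ pos → adjacent-ff⁻ u μ _ _ _ _ (guard-ff⁻ next₁-ff (position-guard u pos)))
          (λ pos → across-ff⁻ u μ _ _ _ _ (guard-ff⁻ next₂-ff (position-guard u pos)))
        next₁-v : (suc i′ ℕ.<ᵇ length v) ≡ true → adjacent v ν (suc i′) i′ (suc i′) i′ ≡ ff
        next₁-v b = blocked-kills _ (blocked (suc i′) (ℕP.n<1+n i′) (guard-position v b) (nothing-between i′))
        next₂-v : (suc (suc i′) ℕ.<ᵇ length v) ≡ true →
                  across v ν (suc (suc i′)) i′ (suc (suc i′)) (suc i′) ≡ ff
        next₂-v b with TimePoint-or-Gap v (suc i′) (position-≤ v (guard-position v b) (suc i′) (ℕP.n≤1+n _))
        ... | inj₁ t = timepoint-across v ν _ _ _ _ t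
        ... | inj₂ g = blocked-kills _ (blocked (suc (suc i′)) (ℕP.m<n⇒m<1+n (ℕP.n<1+n i′))
                                          (guard-position v b) (one-gap-between i′ g))

      next-≼ : ∀ {i i′} → i ~ i′ → ⟦ Next I φ ⟧ u i μ ≼ ⟦ Next I φ ⟧ v i′ ν
      next-≼ ri = keeps (next-keeps-tt ri) (next-keeps-ff ri)

      prev₁-keeps-tt : ∀ {i i′} → i ~ i′ → prev₁ u μ i ≡ tt → prev₁ v ν i′ ≡ tt
      prev₁-keeps-tt {suc k} {i′} ri body with adjacent-tt⁻ u μ (suc k) k k (suc k) body
      ... | tk , tsk with image k tk
      ...   | k′ , rk with consecutive rk ri tk tsk
      ...     | refl = keeps-tt (adjacent-≼ ri rk rk ri (ℕP.n≤1+n k′)) body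

      prev-keeps-tt : ∀ {i i′} → i ~ i′ → ⟦ Prev I φ ⟧ u i μ ≡ tt → ⟦ Prev I φ ⟧ v i′ ν ≡ tt
      prev-keeps-tt {i} {i′} ri e with ∨-tt⁻ (stay u μ i) _ e
      ... | inj₁ s = ⊥-elim (across-not-tt u μ i i i i (guard-tt⁻ (notZero I) s))
      ... | inj₂ e′ with ∨-tt⁻ (prev₁ u μ i) _ e′
      ...   | inj₁ p₁ = ∨-tt⁺ (stay v ν i′) _ (inj₂ (∨-tt⁺ (prev₁ v ν i′) _ (inj₁ (prev₁-keeps-tt ri p₁))))
      ...   | inj₂ p₂ = ⊥-elim (across-not-tt u μ _ _ _ _ (guard-tt⁻ (2 ℕ.≤ᵇ i) p₂))

      prev-keeps-ff : ∀ {i i′} → i ~ i′ → ⟦ Prev I φ ⟧ u i μ ≡ ff → ⟦ Prev I φ ⟧ v i′ ν ≡ ff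
      prev-keeps-ff {i} {i′} ri e =
        ∨-ff⁺ (stay-excluded-v ri excluded) (∨-ff⁺ (prev₁-v i′ ri) (prev₂-v i′ ri))
        where
        stay-ff : stay u μ i ≡ ff
        stay-ff = proj₁ (∨-ff⁻ (stay u μ i) _ e)
        prev₁-ff : prev₁ u μ i ≡ ff
        prev₁-ff = proj₁ (∨-ff⁻ (prev₁ u μ i) _ (proj₂ (∨-ff⁻ (stay u μ i) _ e)))
        prev₂-ff : prev₂ u μ i ≡ ff
        prev₂-ff = proj₂ (∨-ff⁻ (prev₁ u μ i) _ (proj₂ (∨-ff⁻ (stay u μ i) _ e)))
        excluded : StayExcluded i
        excluded = stay-ff⁻ stay-ff
        prev₁-blocked : ∀ k → suc k ≡ i → Blocked u μ i k k
        prev₁-blocked k refl = adjacent-ff⁻ u μ _ _ _ _ prev₁-ff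
        prev₂-blocked : ∀ k → suc (suc k) ≡ i → Blocked u μ i k k ⊎ TimePoint u (suc k)
        prev₂-blocked k refl = across-ff⁻ u μ _ _ _ _ prev₂-ff
        blocked : ∀ {j′} → i ~ j′ → ∀ p′ → p′ ℕ.< j′ → GapsBetween p′ j′ → Blocked v ν j′ p′ p′
        blocked rj = prev-blocked rj excluded prev₁-blocked prev₂-blocked
        prev₁-v : ∀ j′ → i ~ j′ → prev₁ v ν j′ ≡ ff
        prev₁-v zero _ = refl
        prev₁-v (suc k′) rj = blocked-kills _ (blocked rj k′ (ℕP.n<1+n k′) (nothing-between k′))
        prev₂-v : ∀ j′ → i ~ j′ → prev₂ v ν j′ ≡ ff
        prev₂-v zero _ = refl
        prev₂-v (suc zero) _ = refl
        prev₂-v (suc (suc k′)) rj with TimePoint-or-Gap v (suc k′) (position-v-≤ (suc k′) rj (ℕP.n≤1+n _))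
        ... | inj₁ t = timepoint-across v ν _ _ _ _ t
        ... | inj₂ g = blocked-kills _ (blocked rj k′ (ℕP.m<n⇒m<1+n (ℕP.n<1+n k′)) (one-gap-between k′ g))

      prev-≼ : ∀ {i i′} → i ~ i′ → ⟦ Prev I φ ⟧ u i μ ≼ ⟦ Prev I φ ⟧ v i′ ν
      prev-≼ ri = keeps (prev-keeps-tt ri) (prev-keeps-ff ri)

    semantics-≼ : ∀ φ {i i′ μ ν} → i ~ i′ → μ ⊑ᵛ ν → ⟦ φ ⟧ u i μ ≼ ⟦ φ ⟧ v i′ ν
    semantics-≼ T _ _ = keeps (λ _ → refl) (λ ())
    semantics-≼ (Atom p xs) {i} {i′} {μ} {ν} ri μ⊑ν with related ri
    ... | (_ , a) , (_ , b) , eq , eq′ , (_ , a⊑b)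
      rewrite atom-holds u i μ p xs eq | atom-holds v i′ ν p xs eq′ =
        holds-≼ p a⊑b (λ ds → valVec-⊑ xs μ⊑ν)
    semantics-≼ (Freeze r x φ) {i} {i′} {μ} {ν} ri μ⊑ν with related ri
    ... | (_ , a) , (_ , b) , eq , eq′ , (_ , (_ , ρ⊑))
      rewrite freeze-at u i μ r x φ eq | freeze-at v i′ ν r x φ eq′ =
        semantics-≼ φ ri (update-⊑ x μ⊑ν (ρ⊑ r))
    semantics-≼ (Neg φ) ri μ⊑ν = ≼-¬ (semantics-≼ φ ri μ⊑ν)
    semantics-≼ (Or φ ψ) ri μ⊑ν = ≼-∨ (semantics-≼ φ ri μ⊑ν) (semantics-≼ ψ ri μ⊑ν)
    semantics-≼ (Prev I φ) ri μ⊑ν = NextPrev.prev-≼ I φ (λ rk → semantics-≼ φ rk μ⊑ν) ri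
    semantics-≼ (Next I φ) ri μ⊑ν = NextPrev.next-≼ I φ (λ rk → semantics-≼ φ rk μ⊑ν) ri
    semantics-≼ (Since I φ ψ) ri μ⊑ν =
      Temporal.since-≼ I φ ψ (λ rk → semantics-≼ φ rk μ⊑ν) (λ rk → semantics-≼ ψ rk μ⊑ν) ri
    semantics-≼ (Until I φ ψ) ri μ⊑ν =
      Temporal.until-≼ I φ ψ (λ rk → semantics-≼ φ rk μ⊑ν) (λ rk → semantics-≼ ψ rk μ⊑ν) ri

  -- Every transformation replaces one entry e of xs ++ e ∷ ys by a list es
  -- of entries refining e.  Well-formedness survives such a replacement.

  allPairs-++⁻ : ∀ {R : Entry → Entry → Set} xs {ys} → AllPairs R (xs ++ ys) →
                 AllPairs R xs × AllPairs R ys × All (λ x → All (R x) ys) xs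
  allPairs-++⁻ [] ps = [] , ps , []
  allPairs-++⁻ (x ∷ xs) (x<xsys ∷ ps) =
    let (ps-xs , ps-ys , cross) = allPairs-++⁻ xs ps
        (x<xs , x<ys) = Allₚ.++⁻ xs x<xsys
    in (x<xs ∷ ps-xs) , ps-ys , (x<ys ∷ cross)

  before-refineʳ : ∀ {x e e′} → Before x e → Refines e e′ → Before x e′
  before-refineʳ x<e (e′⊆e , _) p q p∈ q∈ = x<e p q p∈ (e′⊆e q q∈)

  before-refineˡ : ∀ {e e′ y} → Refines e e′ → Before e y → Before e′ y
  before-refineˡ (e′⊆e , _) e<y p q p∈ q∈ = e<y p q (e′⊆e p p∈) q∈

  ordered-replace : ∀ xs {e es ys} → AllPairs Before (xs ++ e ∷ ys) → AllPairs Before es →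
                    All (Refines e) es → AllPairs Before (xs ++ es ++ ys)
  ordered-replace xs {e} {es} {ys} ord ord-es refines with allPairs-++⁻ xs ord
  ... | ord-xs , (e<ys ∷ ord-ys) , xs<eys =
    AllPairsₚ.++⁺ ord-xs (AllPairsₚ.++⁺ ord-es ord-ys (All.map (λ {e′} → pieces<ys {e′}) refines))
      (All.map (λ {x} → xs<pieces {x}) xs<eys)
    where
    pieces<ys : ∀ {e′} → Refines e e′ → All (Before e′) ys
    pieces<ys {e′} r = All.map (λ {y} → before-refineˡ {e} {e′} {y} r) e<ys
    xs<pieces : ∀ {x} → All (Before x) (e ∷ ys) → All (Before x) (es ++ ys)
    xs<pieces {x} (x<e ∷ x<ys) = Allₚ.++⁺ (All.map (λ {e′} → before-refineʳ {x} {e} {e′} x<e) refines) x<ys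

  proper-replace : ∀ xs {e es ys} → All Proper (xs ++ e ∷ ys) → All Proper es →
                   All Proper (xs ++ es ++ ys)
  proper-replace xs props props-es with Allₚ.++⁻ xs props
  ... | props-xs , (_ ∷ props-ys) = Allₚ.++⁺ props-xs (Allₚ.++⁺ props-es props-ys)

  -- A gap may be replaced by any list without adjacent gaps, since its
  -- neighbours are not gaps.

  StartsWithNonGap : Word → Set
  StartsWithNonGap [] = ⊤
  StartsWithNonGap (y ∷ _) = ¬ IsGapEntry y

  linked-tail : ∀ {x zs} → Linked NotBothGaps (x ∷ zs) → Linked NotBothGaps zs
  linked-tail [-] = []
  linked-tail (_ ∷ lk) = lk

  after-gap : ∀ {e ys} → IsGapEntry e → Linked NotBothGaps (e ∷ ys) → StartsWithNonGap ys
  after-gap {ys = []} _ _ = _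
  after-gap {ys = y ∷ _} g (nb ∷ _) gy = nb (g , gy)

  cons-nongap : ∀ {x zs} → ¬ IsGapEntry x → Linked NotBothGaps zs → Linked NotBothGaps (x ∷ zs)
  cons-nongap {zs = []} _ _ = [-]
  cons-nongap {zs = z ∷ zs} ng lk = (λ (gx , _) → ng gx) ∷ lk

  linked-++ : ∀ es {ys} → Linked NotBothGaps es → Linked NotBothGaps ys → StartsWithNonGap ys →
              Linked NotBothGaps (es ++ ys)
  linked-++ [] _ lk-ys _ = lk-ys
  linked-++ (x ∷ []) {[]} _ _ _ = [-]
  linked-++ (x ∷ []) {y ∷ ys} _ lk-ys ng = (λ (_ , gy) → ng gy) ∷ lk-ys
  linked-++ (x ∷ x′ ∷ es) (nb ∷ lk) lk-ys ng = nb ∷ linked-++ (x′ ∷ es) lk lk-ys ng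

  linked-replace-gap : ∀ xs {e es ys} → Linked NotBothGaps (xs ++ e ∷ ys) → IsGapEntry e →
                       Linked NotBothGaps es → Linked NotBothGaps (xs ++ es ++ ys)
  linked-replace-gap [] {es = es} lk g lk-es = linked-++ es lk-es (linked-tail lk) (after-gap g lk)
  linked-replace-gap (x ∷ []) (nb ∷ lk) g lk-es =
    cons-nongap (λ gx → nb (gx , g)) (linked-replace-gap [] lk g lk-es)
  linked-replace-gap (x ∷ x′ ∷ xs) (nb ∷ lk) g lk-es = nb ∷ linked-replace-gap (x′ ∷ xs) lk g lk-es

  linked-replace-one : ∀ xs {e e′ ys} → Linked NotBothGaps (xs ++ e ∷ ys) →
                       (IsGapEntry e′ → IsGapEntry e) → Linked NotBothGaps (xs ++ e′ ∷ ys)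
  linked-replace-one [] {ys = []} _ _ = [-]
  linked-replace-one [] {ys = y ∷ ys} (nb ∷ lk) g′⇒g = (λ (g′ , gy) → nb (g′⇒g g′ , gy)) ∷ lk
  linked-replace-one (x ∷ []) (nb ∷ lk) g′⇒g =
    (λ (gx , g′) → nb (gx , g′⇒g g′)) ∷ linked-replace-one [] lk g′⇒g
  linked-replace-one (x ∷ x′ ∷ xs) (nb ∷ lk) g′⇒g = nb ∷ linked-replace-one (x′ ∷ xs) lk g′⇒g

  -- The simulations induced by the transformations.

  ⊑ˡ-refl : ∀ a → a ⊑ˡ a
  ⊑ˡ-refl a = (λ p S eq → eq) , (λ r d eq → eq)

  Refines-refl : ∀ e → Refines e e
  Refines-refl (I , a) = (λ q q∈ → q∈) , ⊑ˡ-refl a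

  identity : ∀ u → Simulation u u
  identity u = record
    { _~_ = λ i i′ → i ≡ i′ × i ℕ.< length u
    ; related = λ { {i} (refl , i<n) → let (e , eq) = <⇒at u i i<n in e , e , eq , eq , Refines-refl e }
    ; preimage = λ i′ (_ , eq) → i′ , refl , at⇒< u i′ eq
    ; monotone = λ { (refl , _) (refl , _) i<j → i<j }
    ; image = λ i (_ , eq , _) → i , refl , at⇒< u i eq
    ; image-unique = λ { _ (refl , _) (refl , _) → refl } }

  data Shifted (R : ℕ → ℕ → Set) : ℕ → ℕ → Set where
    first : Shifted R 0 0
    shift : ∀ {i i′} → R i i′ → Shifted R (suc i) (suc i′)

  cons-simulation : ∀ x {u v} → Simulation u v → Simulation (x ∷ u) (x ∷ v)
  cons-simulation x S = record
    { _~_ = Shifted _~_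
    ; related = λ { first → x , x , refl , refl , Refines-refl x ; (shift r) → related r }
    ; preimage = λ { zero _ → 0 , first
                   ; (suc i′) pos → let (i , r) = preimage i′ pos in suc i , shift r }
    ; monotone = λ { first (shift _) _ → s≤s z≤n
                   ; (shift ri) (shift rj) (s≤s i<j) → s≤s (monotone ri rj i<j) }
    ; image = λ { zero _ → 0 , first
                ; (suc i) t → let (i′ , r) = image i t in suc i′ , shift r }
    ; image-unique = λ { _ first first → refl
                       ; t (shift r) (shift r′) → cong suc (image-unique t r r′) } }
    where open Simulation S

  at-++ˡ : ∀ xs zs i → i ℕ.< length xs → at (xs ++ zs) i ≡ at xs i
  at-++ˡ (x ∷ xs) zs zero _ = refl
  at-++ˡ (x ∷ xs) zs (suc i) (s≤s i<n) = at-++ˡ xs zs i i<n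

  at-++ʳ : ∀ xs zs j → at (xs ++ zs) (length xs + j) ≡ at zs j
  at-++ʳ [] zs j = refl
  at-++ʳ (x ∷ xs) zs j = at-++ʳ xs zs j

  -- Replacing the first entry e of e ∷ ys by es: position 0 corresponds to
  -- all positions of es, position j + 1 to position length es + j.
  data Replaced (k n : ℕ) : ℕ → ℕ → Set where
    inside : ∀ {d} → d ℕ.< k → Replaced k n 0 d
    after : ∀ {j} → j ℕ.< n → Replaced k n (suc j) (k + j)

  head-replacement : ∀ e es ys → All (Refines e) es → (IsSingleton (proj₁ e) → length es ≡ 1) →
                     Simulation (e ∷ ys) (es ++ ys)
  head-replacement e es ys refines single = record
    { _~_ = Replaced k n
    ; related = related
    ; preimage = preimage
    ; monotone = monotone
    ; image = image
    ; image-unique = image-unique }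
    where
    k n : ℕ
    k = length es
    n = length ys

    related : ∀ {i i′} → Replaced k n i i′ →
              Σ Entry λ e₁ → Σ Entry λ e′ →
                at (e ∷ ys) i ≡ just e₁ × at (es ++ ys) i′ ≡ just e′ × Refines e₁ e′
    related (inside {d} d<k) =
      let (e′ , eq) = <⇒at es d d<k in e , e′ , refl , trans (at-++ˡ es ys d d<k) eq , all-at es d refines eq
    related (after {j} j<n) =
      let (y , eq) = <⇒at ys j j<n in y , y , eq , trans (at-++ʳ es ys j) eq , Refines-refl y

    preimage : ∀ i′ → Position (es ++ ys) i′ → Σ ℕ λ i → Replaced k n i i′
    preimage i′ (_ , eq) with i′ ℕ.<? k
    ... | yes i′<k = 0 , inside i′<k
    ... | no i′≮k = suc (i′ ℕ.∸ k) , subst (Replaced k n (suc (i′ ℕ.∸ k))) k+j≡i′ (after j<n)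
      where
      k+j≡i′ : k + (i′ ℕ.∸ k) ≡ i′
      k+j≡i′ = ℕP.m+[n∸m]≡n (ℕP.≮⇒≥ i′≮k)
      j<n : i′ ℕ.∸ k ℕ.< n
      j<n = at⇒< ys (i′ ℕ.∸ k)
              (trans (sym (at-++ʳ es ys (i′ ℕ.∸ k))) (subst (λ m → at (es ++ ys) m ≡ _) (sym k+j≡i′) eq))

    monotone : ∀ {i i′ j j′} → Replaced k n i i′ → Replaced k n j j′ → i ℕ.< j → i′ ℕ.< j′
    monotone (inside d<k) (after {j} _) _ = ℕP.<-≤-trans d<k (ℕP.m≤m+n k j)
    monotone (after _) (after _) (s≤s i<j) = ℕP.+-monoʳ-< k i<j

    image : ∀ i → TimePoint (e ∷ ys) i → Σ ℕ λ i′ → Replaced k n i i′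
    image zero (_ , refl , s) = 0 , inside (subst (0 ℕ.<_) (sym (single s)) (s≤s z≤n))
    image (suc j) (_ , eq , _) = k + j , after (at⇒< ys j eq)

    -- a time point is replaced by a single entry
    image-unique : ∀ {i i′ j′} → TimePoint (e ∷ ys) i → Replaced k n i i′ → Replaced k n i j′ → i′ ≡ j′
    image-unique (_ , refl , s) (inside d<k) (inside d′<k) =
      trans (ℕP.n<1⇒n≡0 (subst (_ ℕ.<_) (single s) d<k)) (sym (ℕP.n<1⇒n≡0 (subst (_ ℕ.<_) (single s) d′<k)))
    image-unique _ (after _) (after _) = refl

  replacement : ∀ xs {e es ys} → All (Refines e) es → (IsSingleton (proj₁ e) → length es ≡ 1) →
                Simulation (xs ++ e ∷ ys) (xs ++ es ++ ys)
  replacement [] {e} {es} {ys} refines single = head-replacement e es ys refines single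
  replacement (x ∷ xs) refines single = cons-simulation x (replacement xs refines single)

  nonsingleton-gap : ∀ I → NonSingleton I → ¬ IsSingleton I
  nonsingleton-gap I (a , b , a∈ , b∈ , a≢b) (τ , _ , unique) = a≢b (trans (unique a a∈) (sym (unique b b∈)))

  singleton-sing : ∀ τ 0≤τ → IsSingleton (sing τ 0≤τ)
  singleton-sing τ _ = τ , refl , λ q q≡τ → q≡τ

  -- The pieces created by (T1) are proper: the open ends of I make
  -- I ∩ [0, τ) and I ∩ (τ, ∞) nonempty and open again.

  lower-proper : ∀ I τ a → mem I τ → 0ℚ ℚ.< τ → NoMax I × NoPosMin I → Proper (I ∩< τ , a)
  lower-proper I τ a τ∈I 0<τ (no-max , no-pos-min) = nonempty , λ _ → lower-no-max , lower-no-pos-min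
    where
    nonempty : Σ ℚ (mem (I ∩< τ))
    nonempty = let (y , y∈I , y<τ) = no-pos-min τ τ∈I 0<τ in y , y∈I , y<τ
    lower-no-max : NoMax (I ∩< τ)
    lower-no-max x (x∈I , x<τ) = let (m , x<m , m<τ) = ℚP.<-dense x<τ in
      m , (convex I x∈I τ∈I (ℚP.<⇒≤ x<m) (ℚP.<⇒≤ m<τ) , m<τ) , x<m
    lower-no-pos-min : NoPosMin (I ∩< τ)
    lower-no-pos-min x (x∈I , x<τ) 0<x = let (y , y∈I , y<x) = no-pos-min x x∈I 0<x in
      y , (y∈I , ℚP.<-trans y<x x<τ) , y<x

  upper-proper : ∀ I τ a → mem I τ → NoMax I × NoPosMin I → Proper (I ∩> τ , a)
  upper-proper I τ a τ∈I (no-max , no-pos-min) = nonempty , λ _ → upper-no-max , upper-no-pos-min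
    where
    nonempty : Σ ℚ (mem (I ∩> τ))
    nonempty = let (y , y∈I , τ<y) = no-max τ τ∈I in y , y∈I , τ<y
    upper-no-max : NoMax (I ∩> τ)
    upper-no-max x (x∈I , τ<x) = let (y , y∈I , x<y) = no-max x x∈I in
      y , (y∈I , ℚP.<-trans τ<x x<y) , x<y
    upper-no-pos-min : NoPosMin (I ∩> τ)
    upper-no-pos-min x (x∈I , τ<x) _ = let (m , τ<m , m<x) = ℚP.<-dense τ<x in
      m , (convex I τ∈I x∈I (ℚP.<⇒≤ τ<m) (ℚP.<⇒≤ m<x) , τ<m) , m<x

  point-proper : ∀ τ 0≤τ a → Proper (sing τ 0≤τ , a)
  point-proper τ 0≤τ a = (τ , refl) , λ not-single → ⊥-elim (not-single (singleton-sing τ 0≤τ))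

  proper-at : ∀ xs {e ys} → All Proper (xs ++ e ∷ ys) → Proper e
  proper-at xs props with Allₚ.++⁻ xs props
  ... | _ , (prop ∷ _) = prop

  replace-gap : ∀ xs {e es ys} → WellFormed (xs ++ e ∷ ys) → IsGapEntry e →
                WellFormed es → All (Refines e) es →
                WellFormed (xs ++ es ++ ys) × Simulation (xs ++ e ∷ ys) (xs ++ es ++ ys)
  replace-gap xs (ord , lk , props) gap (ord-es , lk-es , props-es) refines =
    (ordered-replace xs ord ord-es refines , linked-replace-gap xs lk gap lk-es ,
     proper-replace xs props props-es) ,
    replacement xs refines (λ single → ⊥-elim (gap single))

  step-simulation : ∀ {u v} → Step u v → WellFormed u → WellFormed v × Simulation u v
  step-simulation (T1 xs ys I a τ ns τ∈I 0<τ) wf@(_ , _ , props) =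
    replace-gap xs wf (nonsingleton-gap I ns) (ord , lk , proper) refines
    where
    point : Interval
    point = sing τ (nonneg I τ∈I)
    open-ends : NoMax I × NoPosMin I
    open-ends = proj₂ (proper-at xs props) (nonsingleton-gap I ns)
    ord : AllPairs Before ((I ∩< τ , a) ∷ (point , a) ∷ (I ∩> τ , a) ∷ [])
    ord = ((λ p q p∈ q≡τ → subst (p ℚ.<_) (sym q≡τ) (proj₂ p∈)) ∷
           (λ p q p∈ q∈ → ℚP.<-trans (proj₂ p∈) (proj₂ q∈)) ∷ []) ∷
          ((λ p q p≡τ q∈ → subst (ℚ._< q) (sym p≡τ) (proj₂ q∈)) ∷ []) ∷ [] ∷ []
    lk : Linked NotBothGaps ((I ∩< τ , a) ∷ (point , a) ∷ (I ∩> τ , a) ∷ [])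
    lk = (λ (_ , g) → g (singleton-sing τ (nonneg I τ∈I))) ∷
         (λ (g , _) → g (singleton-sing τ (nonneg I τ∈I))) ∷ [-]
    proper : All Proper ((I ∩< τ , a) ∷ (point , a) ∷ (I ∩> τ , a) ∷ [])
    proper = lower-proper I τ a τ∈I 0<τ open-ends ∷ point-proper τ (nonneg I τ∈I) a ∷
             upper-proper I τ a τ∈I open-ends ∷ []
    refines : All (Refines (I , a)) ((I ∩< τ , a) ∷ (point , a) ∷ (I ∩> τ , a) ∷ [])
    refines = ((λ q → proj₁) , ⊑ˡ-refl a) ∷ ((λ q q≡τ → subst (mem I) (sym q≡τ) τ∈I) , ⊑ˡ-refl a) ∷
              ((λ q → proj₁) , ⊑ˡ-refl a) ∷ []
  step-simulation (T1₀ xs ys I a ns 0∈I) wf@(_ , _ , props) =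
    replace-gap xs wf (nonsingleton-gap I ns) (ord , lk , proper) refines
    where
    point : Interval
    point = sing 0ℚ (nonneg I 0∈I)
    ord : AllPairs Before ((point , a) ∷ (I ∩> 0ℚ , a) ∷ [])
    ord = ((λ p q p≡0 q∈ → subst (ℚ._< q) (sym p≡0) (proj₂ q∈)) ∷ []) ∷ [] ∷ []
    lk : Linked NotBothGaps ((point , a) ∷ (I ∩> 0ℚ , a) ∷ [])
    lk = (λ (g , _) → g (singleton-sing 0ℚ (nonneg I 0∈I))) ∷ [-]
    proper : All Proper ((point , a) ∷ (I ∩> 0ℚ , a) ∷ [])
    proper = point-proper 0ℚ (nonneg I 0∈I) a ∷
             upper-proper I 0ℚ a 0∈I (proj₂ (proper-at xs props) (nonsingleton-gap I ns)) ∷ []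
    refines : All (Refines (I , a)) ((point , a) ∷ (I ∩> 0ℚ , a) ∷ [])
    refines = ((λ q q≡0 → subst (mem I) (sym q≡0) 0∈I) , ⊑ˡ-refl a) ∷ ((λ q → proj₁) , ⊑ˡ-refl a) ∷ []
  step-simulation (T2 xs ys I a ns _) wf =
    replace-gap xs wf (nonsingleton-gap I ns) ([] , [] , []) []
  step-simulation (T3 xs ys I a a′ single a⊑a′) (ord , lk , props) =
    (ordered-replace xs ord ([] ∷ []) (refines ∷ []) , linked-replace-one xs lk (λ g → g) ,
     proper-replace xs props (proper-at xs props ∷ [])) ,
    replacement xs (refines ∷ []) (λ _ → refl)
    where
    refines : Refines (I , a) (I , a′)
    refines = (λ q q∈ → q∈) , a⊑a′

  -- Timestamps.

  timepoint-at⁻ : ∀ w τ i → TimePointAt w τ i →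
                  Σ Entry λ e → at w i ≡ just e × IsSingletonOf (proj₁ e) τ
  timepoint-at⁻ w τ i t with at w i
  ... | just e = e , refl , t
  ... | nothing = ⊥-elim t

  timepoint-at⁺ : ∀ w τ i {e} → at w i ≡ just e → IsSingletonOf (proj₁ e) τ → TimePointAt w τ i
  timepoint-at⁺ w τ i eq s with at w i
  timepoint-at⁺ w τ i refl s | just _ = s

  -- entries of a well-formed word are disjoint, so a timestamp names at most one position
  timestamp-unique : ∀ {w} τ → WellFormed w → ∀ {i j} → TimePointAt w τ i → TimePointAt w τ j → i ≡ j
  timestamp-unique {w} τ wf {i} {j} ti tj
    with timepoint-at⁻ w τ i ti | timepoint-at⁻ w τ j tj | ℕP.<-cmp i j
  ... | _ , eqᵢ , (τ∈ᵢ , _) | _ , eqⱼ , (τ∈ⱼ , _) | tri< i<j _ _ =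
    ⊥-elim (ℚP.<-irrefl refl (before-at wf i<j eqᵢ eqⱼ τ τ τ∈ᵢ τ∈ⱼ))
  ... | _ | _ | tri≈ _ i≡j _ = i≡j
  ... | _ , eqᵢ , (τ∈ᵢ , _) | _ , eqⱼ , (τ∈ⱼ , _) | tri> _ _ j<i =
    ⊥-elim (ℚP.<-irrefl refl (before-at wf j<i eqⱼ eqᵢ τ τ τ∈ⱼ τ∈ᵢ))

  timestamp-at : ∀ φ τ {w ν i} → WellFormed w → TimePointAt w τ i → (⟦ φ ⟧^ τ) w ν ≡ ⟦ φ ⟧ w i ν
  timestamp-at φ τ {w} {ν} {i} wf ti with lem (Σ ℕ λ j → TimePointAt w τ j)
  ... | yes (j , tj) = cong (λ k → ⟦ φ ⟧ w k ν) (timestamp-unique τ wf tj ti)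
  ... | no none = ⊥-elim (none (i , ti))

  timestamp-none : ∀ φ τ {w ν} → ¬ (Σ ℕ λ i → TimePointAt w τ i) → (⟦ φ ⟧^ τ) w ν ≡ ⊥v
  timestamp-none φ τ {w} none with lem (Σ ℕ λ j → TimePointAt w τ j)
  ... | yes some = ⊥-elim (none some)
  ... | no _ = refl

  -- A simulated time point keeps its timestamp: its image has a nonempty
  -- interval inside {τ}.
  timestamp-image : ∀ {u v} (S : Simulation u v) → WellFormed v → ∀ τ {i i′} →
                    Simulation._~_ S i i′ → TimePointAt u τ i → TimePointAt v τ i′
  timestamp-image {u} {v} S wf-v τ {i} {i′} ri ti with timepoint-at⁻ u τ i ti | Simulation.related S ri
  ... | e₀ , eq₀ , (τ∈I , unique) | (I , a) , (J , b) , eq , eq′ , (J⊆I , _) with trans (sym eq₀) eq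
  ... | refl = let (x , x∈J) = nonempty-at wf-v eq′ in
    timepoint-at⁺ v τ i′ eq′ (subst (mem J) (unique x (J⊆I x x∈J)) x∈J , λ q q∈J → unique q (J⊆I q q∈J))

  simulation-⪯ : ∀ {u v} → WellFormed u → WellFormed v → Simulation u v →
                 ∀ φ τ {μ ν} → μ ⊑ᵛ ν → (⟦ φ ⟧^ τ) u μ ⪯ (⟦ φ ⟧^ τ) v ν
  simulation-⪯ {u} {v} wf-u wf-v S φ τ {μ} {ν} μ⊑ν = by-timestamp (lem (Σ ℕ λ i → TimePointAt u τ i))
    where
    by-timestamp : Dec (Σ ℕ λ i → TimePointAt u τ i) → (⟦ φ ⟧^ τ) u μ ⪯ (⟦ φ ⟧^ τ) v ν
    by-timestamp (no none) = inj₁ (timestamp-none φ τ none)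
    by-timestamp (yes (i , ti)) =
      let (e , eq , (τ∈ , unique)) = timepoint-at⁻ u τ i ti
          (i′ , ri) = Simulation.image S i (e , eq , τ , τ∈ , unique)
      in subst₂ _⪯_ (sym (timestamp-at φ τ wf-u ti))
                    (sym (timestamp-at φ τ wf-v (timestamp-image S wf-v τ ri ti)))
           (≼⇒⪯ (Along.semantics-≼ S wf-u wf-v φ ri μ⊑ν))

  ⊑ᵛ-refl : ∀ {ν} → ν ⊑ᵛ ν
  ⊑ᵛ-refl x d eq = eq

  refinement-⪯ : ∀ {u v} → u ⊑ᵒ v → WellFormed u → ∀ φ τ {μ ν} → μ ⊑ᵛ ν →
                 (⟦ φ ⟧^ τ) u μ ⪯ (⟦ φ ⟧^ τ) v ν
  refinement-⪯ {u} ε wf φ τ μ⊑ν = simulation-⪯ wf wf (identity u) φ τ μ⊑ν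
  refinement-⪯ (step ◅ steps) wf φ τ μ⊑ν =
    let (wf′ , S) = step-simulation step wf in
    ⪯-trans (simulation-⪯ wf wf′ S φ τ μ⊑ν) (refinement-⪯ steps wf′ φ τ ⊑ᵛ-refl)

  initial-well-formed : WellFormed initial
  initial-well-formed = [] ∷ [] , [-] , ((0ℚ , ℚP.≤-refl) , λ _ → no-max , no-pos-min) ∷ []
    where
    no-max : NoMax [0,∞[
    no-max x 0≤x = x ℚ.+ 1ℚ , ℚP.≤-trans 0≤x (ℚP.<⇒≤ x<x+1) , x<x+1
      where
      x<x+1 : x ℚ.< x ℚ.+ 1ℚ
      x<x+1 = subst (ℚ._< x ℚ.+ 1ℚ) (ℚP.+-identityʳ x) (ℚP.+-monoʳ-< x (ℚP.positive⁻¹ 1ℚ))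
    no-pos-min : NoPosMin [0,∞[
    no-pos-min x _ 0<x = 0ℚ , ℚP.≤-refl , 0<x

  refinement-well-formed : ∀ {u v} → u ⊑ᵒ v → WellFormed u → WellFormed v
  refinement-well-formed ε wf = wf
  refinement-well-formed (step ◅ steps) wf = refinement-well-formed steps (proj₁ (step-simulation step wf))

theorem3p6 : (nP : ℕ) (ι : Fin nP → ℕ) (V : Set) (nR : ℕ) (D : Set) (d₀ : D)
    (lem : LEM) →
    let open Setting nP ι V nR D lem in
    (φ : Formula) (μ ν : Val) (u v : Word) (τ : ℚ) → 0ℚ ≤ τ →
    IsObservation u → u ⊑ᵒ v → μ ⊑ᵛ ν →
    (⟦ φ ⟧^ τ) u μ ⪯ (⟦ φ ⟧^ τ) v ν
theorem3p6 nP ι V nR D _ lem φ μ ν u v τ _ observation u⊑v μ⊑ν =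
  refinement-⪯ u⊑v (refinement-well-formed observation initial-well-formed) φ τ μ⊑ν
  where open Monotonicity nP ι V nR D lem
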